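{- Let $\Sigma$ be a first-order language without relation symbols (except possibly equality). Let $\mathcal{A}$, $(\mathcal{B}_i)_{i\ge-1}$ be mass problems satisfying the hypotheses of the interval construction and let $\mathfrak{M}$ be a structure for $\Sigma$ in $[(\mathcal{B}_i)_{i\ge-1},\mathcal{A}]_{\mathcal{P}_{\mathcal{M}}}$ with universe $M$. Let $\phi(x_1,\dots,x_n)$ be a $\Delta^0_0$-formula and let $a_1,\dots,a_n\in M$. Then either $\llbracket\phi(x_1,\dots,x_n)\rrbracket_{\langle a_1,\dots,a_n\rangle}\equiv_{\mathcal{M}}\mathcal{B}_{ -1}\oplus\mathcal{B}_{a_1}\oplus\dots\oplus\mathcal{B}_{a_n}$ or $\llbracket\phi(x_1,\dots,x_n)\rrbracket_{\langle a_1,\dots,a_n\rangle}\equiv_{\mathcal{M}}\mathcal{A}$, with the first holding if and only if $\phi(a_1,\dots,a_n)$ holds classically in the classical model induced by $\mathfrak{M}$ (the classical structure with universe $M$ and functions as in $\mathfrak{M}$, equality interpreted as identity). Furthermore, it is decidable (given $a_1,\dots,a_n$) which of the two cases holds, and the reductions witnessing the equivalence are uniform in $a_1,\dots,a_n$.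
   Context: Medvedev notions: mass problems are subsets of $\omega^\omega$; $(f\oplus g)(2n)=f(n)$, $(f\oplus g)(2n+1)=g(n)$; $n^\frown f$ is $f$ preceded by $n$; $\Phi_e$ the $e$-th partial Turing functional. $\mathcal{A}\le_{\mathcal{M}}\mathcal{B}$ iff some partial Turing functional $\Phi$ has $\Phi(\mathcal{B})\subseteq\mathcal{A}$ ($\equiv_{\mathcal{M}}$ is the induced equivalence); $\mathcal{M}$ is the Brouwer algebra of degrees with join $\{f\oplus g\}$, meet $0^\frown\mathcal{A}\cup1^\frown\mathcal{B}$, implication $\{e^\frown f:\forall g\in\mathcal{A}\,\Phi_e(g\oplus f)\in\mathcal{B}\}$. $(\mathcal{A}_i)\le_{\mathcal{M}_\omega}(\mathcal{B}_i)$ iff a single $\Phi$ has $\Phi(n^\frown\mathcal{B}_n)\subseteq\mathcal{A}_n$ for all $n$; $\mathcal{M}_\omega$ is the Brouwer algebra of these degrees. Intervals $[x,y]$ have implication $(u\to v)\oplus x$. Interval hyperdoctrine: hypotheses: $(\mathcal{A},\mathcal{A},\dots)\ge_{\mathcal{M}_\omega}(\mathcal{B}_i)_{i\in\omega}\ge_{\mathcal{M}_\omega}(\mathcal{B}_{ -1},\mathcal{B}_{ -1},\dots)$ and $\mathcal{B}_i\not\ge_{\mathcal{M}}\mathcal{A}$ for all $i\ge-1$; $\mathcal{B}_{(y_1,\dots,y_n)}=\mathcal{B}_{y_1}\oplus\dots\oplus\mathcal{B}_{y_n}$. Base category: objects $\{1,\dots,m\}^n$ and $\omega^n$; morphisms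 the computable $\alpha$ with $\mathcal{B}_y\ge_{\mathcal{M}}\mathcal{B}_{\alpha(y)}$ uniformly in $y$. $\omega^n\mapsto[(\mathcal{B}_{a_1}\oplus\dots\oplus\mathcal{B}_{a_n})_{\langle a_1,\dots,a_n\rangle},(\mathcal{A},\mathcal{A},\dots)]_{\mathcal{M}_\omega}$ (finite powers analogously), $\alpha:Y\to Z\mapsto(x\mapsto\alpha^*(x)\oplus(\mathcal{B}_i)_{i\in Y})$ with $\alpha^*((\mathcal{C}_j))_i=\mathcal{C}_{\alpha(i)}$. It is a first-order hyperdoctrine with left/right adjoints $\forall/\exists$ along projections and equality elements $=_X$ ($\Delta_X^*(A)\le0$ iff $A\le{=_X}$). Structures: universe an object $M$, $n$-ary function symbols as morphisms $M^n\to M$ of the base category. A formula $\phi(x_1,\dots,x_n)$ is interpreted as $\llbracket\phi\rrbracket\in\mathcal{P}(M^n)$ (a sequence indexed by $\langle a_1,\dots,a_n\rangle$): $t_1=t_2$ via pullback of $=_M$ along $(\llbracket t_1\rrbracket,\llbracket t_2\rrbracket)$, $\top$/$\bot$ as bottom/top, $\vee$ as $\otimes$, $\wedge$ as $\oplus$, $\to$ as implication, $\exists/\forall$ as right/left adjoints along projections. $\llbracket\phi\rrbracket_{\langle a_1,\dots,a_n\rangle}$ denotes its component at index $\langle a_1,\dots,a_n\rangle$. -}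

module Defs where

open import Data.Nat using (ℕ; zero; suc; _+_; _*_; _∸_; _≤ᵇ_; _%_; _/_)
open import Data.Fin using (Fin)
open import Data.Vec using (Vec; []; _∷_; lookup; concat)
open import Data.Vec.Relation.Unary.All using (All)
open import Data.Maybe using (Maybe; just; nothing)
open import Data.Product using (Σ; _×_; _,_; proj₁; proj₂)
open import Data.Sum using (_⊎_)
open import Data.Unit using (⊤)
open import Data.Empty using (⊥)
open import Data.Bool using (if_then_else_)
open import Relation.Binary.PropositionalEquality using (_≡_)
open import Relation.Nullary using (¬_)

Baire : Set
Baire = ℕ → ℕ

MassProblem : Set₁
MassProblem = Baire → Set

tri : ℕ → ℕ
tri zero    = 0
tri (suc n) = suc n + tri n

pair : ℕ → ℕ → ℕ
pair a b = tri (a + b) + a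

-- unpairing with fuel: n = tri w + rem, 0 ≤ rem ≤ w  ↦  (rem , w ∸ rem)
unpairAux : ℕ → ℕ → ℕ → ℕ × ℕ
unpairAux zero       w rem = rem , w ∸ rem
unpairAux (suc fuel) w rem =
  if rem ≤ᵇ w then (rem , w ∸ rem) else unpairAux fuel (suc w) (rem ∸ suc w)

unpair : ℕ → ℕ × ℕ
unpair n = unpairAux n 0 n

code : ∀ {k} → Vec ℕ k → ℕ
code []       = 0
code (x ∷ xs) = suc (pair x (code xs))

-- Oracle computations: codes of partial recursive functionals
-- (unary, using Cantor pairing), relative to an oracle f : Baire.

data Code : Set where
  cZ cS cI cO cFst cSnd : Code
  cPair cComp cRec : Code → Code → Code
  cMu : Code → Code

data Ev (f : Baire) : Code → ℕ → ℕ → Set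
data EvRec (f : Baire) (c d : Code) (x : ℕ) : ℕ → ℕ → Set
data EvMu (f : Baire) (c : Code) (x : ℕ) : ℕ → ℕ → Set

data Ev f where
  ev-Z    : ∀ {x} → Ev f cZ x 0
  ev-S    : ∀ {x} → Ev f cS x (suc x)
  ev-I    : ∀ {x} → Ev f cI x x
  ev-O    : ∀ {x} → Ev f cO x (f x)
  ev-Fst  : ∀ {x} → Ev f cFst x (proj₁ (unpair x))
  ev-Snd  : ∀ {x} → Ev f cSnd x (proj₂ (unpair x))
  ev-Pair : ∀ {c d x y z} → Ev f c x y → Ev f d x z → Ev f (cPair c d) x (pair y z)
  ev-Comp : ∀ {c d x y z} → Ev f d x y → Ev f c y z → Ev f (cComp c d) x z
  -- primitive recursion on input ⟨x , n⟩
  ev-Rec  : ∀ {c d x y} →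
            EvRec f c d (proj₁ (unpair x)) (proj₂ (unpair x)) y → Ev f (cRec c d) x y
  -- unbounded search: least m with c⟨x , m⟩ = 0
  ev-Mu   : ∀ {c x y} → EvMu f c x 0 y → Ev f (cMu c) x y

data EvRec f c d x where
  rec-zero : ∀ {y} → Ev f c x y → EvRec f c d x 0 y
  rec-suc  : ∀ {n y z} → EvRec f c d x n y → Ev f d (pair x (pair n y)) z →
             EvRec f c d x (suc n) z

data EvMu f c x where
  mu-found : ∀ {m} → Ev f c (pair x m) 0 → EvMu f c x m m
  mu-next  : ∀ {m k r} → Ev f c (pair x m) (suc k) → EvMu f c x (suc m) r →
             EvMu f c x m r

Computes : Code → Baire → Baire → Set
Computes c f g = ∀ n → Ev f c n (g n)

-- Gödel numbering e ↦ Φ_e (with fuel; decode (suc fuel) is enough)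
decodeF : ℕ → ℕ → Code
decodeF zero       n = cZ
decodeF (suc fuel) n = sel (n % 10)
  where
  r = n / 10
  p = proj₁ (unpair r)
  q = proj₂ (unpair r)
  sel : ℕ → Code
  sel 0 = cZ
  sel 1 = cS
  sel 2 = cI
  sel 3 = cO
  sel 4 = cFst
  sel 5 = cSnd
  sel 6 = cPair (decodeF fuel p) (decodeF fuel q)
  sel 7 = cComp (decodeF fuel p) (decodeF fuel q)
  sel 8 = cRec (decodeF fuel p) (decodeF fuel q)
  sel _ = cMu (decodeF fuel r)

decode : ℕ → Code
decode n = decodeF (suc n) n

-- oracle used for plain (non-relativised) computations
zeroOracle : Baire
zeroOracle _ = 0

_⌢_ : ℕ → Baire → Baire
(n ⌢ f) zero    = n
(n ⌢ f) (suc k) = f k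

tail : Baire → Baire
tail h k = h (suc k)

-- f ⊕ g : (f ⊕ g)(2n) = f n , (f ⊕ g)(2n+1) = g n
joinF : Baire → Baire → Baire
joinF f g zero          = f 0
joinF f g (suc zero)    = g 0
joinF f g (suc (suc n)) = joinF (λ k → f (suc k)) (λ k → g (suc k)) n

_⊕ᴹ_ : MassProblem → MassProblem → MassProblem
(A ⊕ᴹ B) h = Σ Baire λ f → Σ Baire λ g → A f × B g × (∀ n → h n ≡ joinF f g n)

_⊗ᴹ_ : MassProblem → MassProblem → MassProblem
(A ⊗ᴹ B) h = (h 0 ≡ 0 × A (tail h)) ⊎ (h 0 ≡ 1 × B (tail h))

_→ᴹ_ : MassProblem → MassProblem → MassProblem
(A →ᴹ B) h = ∀ g → A g →
  Σ Baire λ k → Computes (decode (h 0)) (joinF g (tail h)) k × B k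

-- the least Medvedev degree / unit of ⊕ (all of ω^ω)
Univ : MassProblem
Univ _ = ⊤

_≤ᴹ_ : MassProblem → MassProblem → Set
A ≤ᴹ B = Σ Code λ c → ∀ f → B f → Σ Baire λ g → Computes c f g × A g

-- uniform reduction at index k: Φ_c(k⌢D) ⊆ C  (the M_ω-style component)
URed : Code → ℕ → MassProblem → MassProblem → Set
URed c k C D = ∀ f → D f → Σ Baire λ g → Computes c (k ⌢ f) g × C g

record IntervalHyp (A B₋₁ : MassProblem) (B : ℕ → MassProblem) : Set where
  field
    -- (A, A, ...) ≥_{M_ω} (B_i)_i
    A≥B   : Σ Code λ c → ∀ i → URed c i (B i) A
    -- (B_i)_i ≥_{M_ω} (B₋₁, B₋₁, ...)
    B≥B₋₁ : Σ Code λ c → ∀ i → URed c i B₋₁ (B i)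
    B₋₁≱A : ¬ (A ≤ᴹ B₋₁)
    B≱A   : ∀ i → ¬ (A ≤ᴹ B i)

-- Objects of the base category: {1,…,m}^n (bound = just m) and ω^n (bound = nothing)

record Obj : Set where
  field
    dim   : ℕ
    bound : Maybe ℕ
open Obj public

InRange : Maybe ℕ → ℕ → Set
InRange nothing  x = ⊤
InRange (just m) x = (1 Data.Nat.≤ x) × (x Data.Nat.≤ m)

InObj : (X : Obj) → Vec ℕ (dim X) → Set
InObj X y = All (InRange (bound X)) y

_^ᴼ_ : Obj → ℕ → Obj
X ^ᴼ n = record { dim = n * dim X ; bound = bound X }

record Signature : Set₁ where
  field
    Sym   : Set
    arity : Sym → ℕ
open Signature public

data Term (Sig : Signature) (n : ℕ) : Set where
  var : Fin n → Term Sig n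
  app : (f : Sym Sig) → Vec (Term Sig n) (arity Sig f) → Term Sig n

data Δ₀₀Formula (Sig : Signature) (n : ℕ) : Set where
  _≐_  : Term Sig n → Term Sig n → Δ₀₀Formula Sig n
  ⊤ᶠ ⊥ᶠ : Δ₀₀Formula Sig n
  _∧ᶠ_ _∨ᶠ_ _⇒ᶠ_ : Δ₀₀Formula Sig n → Δ₀₀Formula Sig n → Δ₀₀Formula Sig n

module Interval (A B₋₁ : MassProblem) (B : ℕ → MassProblem) where

  joinB : ∀ {k} → Vec ℕ k → MassProblem
  joinB []       = Univ
  joinB (y ∷ ys) = B y ⊕ᴹ joinB ys

  -- bottom of P(X) at index y : B_{-1} ⊕ B_{y₁} ⊕ ... ⊕ B_{y_k}
  Bt : ∀ {k} → Vec ℕ k → MassProblem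
  Bt y = B₋₁ ⊕ᴹ joinB y

  record IsMorphism (X Y : Obj) (α : Vec ℕ (dim X) → Vec ℕ (dim Y)) : Set where
    field
      preserves  : ∀ y → InObj X y → InObj Y (α y)
      computable : Σ Code λ c → ∀ y → InObj X y → Ev zeroOracle c (code y) (code (α y))
      uniform    : Σ Code λ c → ∀ y → InObj X y → URed c (code y) (Bt (α y)) (Bt y)

  record Structure (Sig : Signature) (M : Obj) : Set where
    field
      fun   : (f : Sym Sig) → Vec ℕ (arity Sig f * dim M) → Vec ℕ (dim M)
      isMor : (f : Sym Sig) → IsMorphism (M ^ᴼ arity Sig f) M (fun f)

  module _ {Sig : Signature} {M : Obj} (𝔐 : Structure Sig M) where
    open Structure 𝔐

    evalT  : ∀ {n} → Term Sig n → Vec (Vec ℕ (dim M)) n → Vec ℕ (dim M)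
    evalTs : ∀ {n k} → Vec (Term Sig n) k → Vec (Vec ℕ (dim M)) n → Vec (Vec ℕ (dim M)) k
    evalT (var i)    a = lookup a i
    evalT (app f ts) a = fun f (concat (evalTs ts a))
    evalTs []       a = []
    evalTs (t ∷ ts) a = evalT t a ∷ evalTs ts a

    EqM : Vec ℕ (dim M) → Vec ℕ (dim M) → MassProblem
    EqM x x' h = (x ≡ x' × Bt (concat (x ∷ x' ∷ [])) h) ⊎ (¬ x ≡ x' × A h)

    ⟦_⟧ : ∀ {n} → Δ₀₀Formula Sig n → Vec (Vec ℕ (dim M)) n → MassProblem
    ⟦ t₁ ≐ t₂ ⟧ a = EqM (evalT t₁ a) (evalT t₂ a) ⊕ᴹ Bt (concat a)
    ⟦ ⊤ᶠ ⟧      a = Bt (concat a)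
    ⟦ ⊥ᶠ ⟧      a = A
    ⟦ φ ∧ᶠ ψ ⟧  a = ⟦ φ ⟧ a ⊕ᴹ ⟦ ψ ⟧ a
    ⟦ φ ∨ᶠ ψ ⟧  a = ⟦ φ ⟧ a ⊗ᴹ ⟦ ψ ⟧ a
    ⟦ φ ⇒ᶠ ψ ⟧  a = (⟦ φ ⟧ a →ᴹ ⟦ ψ ⟧ a) ⊕ᴹ Bt (concat a)

    Holds : ∀ {n} → Δ₀₀Formula Sig n → Vec (Vec ℕ (dim M)) n → Set
    Holds (t₁ ≐ t₂) a = evalT t₁ a ≡ evalT t₂ a
    Holds ⊤ᶠ        a = ⊤
    Holds ⊥ᶠ        a = ⊥
    Holds (φ ∧ᶠ ψ)  a = Holds φ a × Holds ψ a
    Holds (φ ∨ᶠ ψ)  a = Holds φ a ⊎ Holds ψ a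
    Holds (φ ⇒ᶠ ψ)  a = Holds φ a → Holds ψ a

module Submission where

-- An equation t₁ ≐ t₂ is decided by comparing the codes of the values of t₁ and t₂;
-- its mass problem is computed from B_a through the uniform reductions that make
-- the function symbols morphisms, and A computes every Bt.  For the connectives,
-- the Medvedev operations are applied to the two possible values, each reduction
-- consulting the decision codes of the subformulas to pick the right case.
-- Implication is the delicate case: an element e ⌢ f of ⟦φ⟧ → ⟦ψ⟧ is built with
-- e the Gödel number of a fixed program, and modus ponens has to run a program
-- given only by its index, which requires a universal functional.

open import Defs
open import Data.Nat
open import Data.Nat.Properties
open import Data.Nat.DivMod
open import Data.Bool using (true; false; T)
open import Data.Bool.Properties using (T-≡)
open import Data.Fin using (Fin; zero; suc; toℕ)
open import Data.Vec using (Vec; []; _∷_; lookup; concat; _++_)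
open import Data.Vec.Relation.Unary.All using (All; []; _∷_)
open import Data.Vec.Relation.Unary.All.Properties using (lookup⁺; concat⁺)
open import Data.List using (List; []; _∷_)
open import Data.Product using (Σ; _×_; _,_; proj₁; proj₂)
open import Data.Sum using (_⊎_; inj₁; inj₂)
import Data.Sum
open import Data.Unit using (⊤; tt)
open import Data.Empty using (⊥-elim)
open import Function.Base using (_∘_; case_of_)
open import Function.Bundles using (Equivalence)
open import Relation.Nullary using (¬_)
open import Relation.Binary.PropositionalEquality
open import Relation.Binary.Construct.Closure.ReflexiveTransitive using (Star; ε; _◅_)
open import Relation.Binary.Construct.Closure.ReflexiveTransitive.Properties using (module StarReasoning)

fst snd : ℕ → ℕ
fst x = proj₁ (unpair x)
snd x = proj₂ (unpair x)

≤ᵇ-true : ∀ {m n} → m ≤ n → (m ≤ᵇ n) ≡ true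
≤ᵇ-true m≤n = Equivalence.to T-≡ (≤⇒≤ᵇ m≤n)

≤ᵇ-false : ∀ {m n} → n < m → (m ≤ᵇ n) ≡ false
≤ᵇ-false {m} {n} n<m with m ≤ᵇ n in eq
... | false = refl
... | true  = ⊥-elim (<⇒≱ n<m (≤ᵇ⇒≤ m n (Equivalence.from T-≡ eq)))

≤ᵇ-false⇒> : ∀ {m n} → (m ≤ᵇ n) ≡ false → n < m
≤ᵇ-false⇒> {m} {n} eq = ≰⇒> (λ m≤n → subst T eq (≤⇒≤ᵇ m≤n))

-- beyond w d a is the remainder which unpairAux, started on diagonal w,
-- brings down to a after passing the d diagonals w+1, …, w+d.
beyond : ℕ → ℕ → ℕ → ℕ
beyond w zero    a = a
beyond w (suc d) a = suc w + beyond (suc w) d a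

unpairAux-beyond : ∀ fuel w d a → a ≤ w + d → d ≤ fuel →
                   unpairAux fuel w (beyond w d a) ≡ (a , (w + d) ∸ a)
unpairAux-beyond zero    w zero    a _ _ rewrite +-identityʳ w = refl
unpairAux-beyond (suc f) w zero    a a≤w _ rewrite +-identityʳ w | ≤ᵇ-true a≤w = refl
unpairAux-beyond (suc f) w (suc d) a a≤w+d (s≤s d≤f)
  rewrite ≤ᵇ-false {suc w + beyond (suc w) d a} {w} (m≤m+n (suc w) _)
        | m+n∸m≡n (suc w) (beyond (suc w) d a)
        | unpairAux-beyond f (suc w) d a (subst (a ≤_) (+-suc w d) a≤w+d) d≤f
        | +-suc w d = refl

tri-beyond : ∀ w d a → tri w + beyond w d a ≡ tri (w + d) + a
tri-beyond w zero    a rewrite +-identityʳ w = refl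
tri-beyond w (suc d) a = begin
  tri w + (suc w + beyond (suc w) d a)  ≡⟨ sym (+-assoc (tri w) (suc w) _) ⟩
  tri w + suc w + beyond (suc w) d a    ≡⟨ cong (_+ beyond (suc w) d a) (+-comm (tri w) (suc w)) ⟩
  tri (suc w) + beyond (suc w) d a      ≡⟨ tri-beyond (suc w) d a ⟩
  tri (suc w + d) + a                   ≡⟨ cong (λ z → tri z + a) (sym (+-suc w d)) ⟩
  tri (w + suc d) + a                   ∎
  where open ≡-Reasoning

n≤tri[n] : ∀ n → n ≤ tri n
n≤tri[n] zero    = z≤n
n≤tri[n] (suc n) = m≤m+n (suc n) (tri n)

unpair-pair : ∀ a b → unpair (pair a b) ≡ (a , b)
unpair-pair a b = begin
  unpair (pair a b)                               ≡⟨ cong unpair (sym pair≡beyond) ⟩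
  unpairAux (beyond 0 (a + b) a) 0 (beyond 0 (a + b) a)
                                                  ≡⟨ unpairAux-beyond _ 0 (a + b) a (m≤m+n a b) enoughFuel ⟩
  (a , (a + b) ∸ a)                               ≡⟨ cong (a ,_) (m+n∸m≡n a b) ⟩
  (a , b)                                         ∎
  where
  open ≡-Reasoning
  pair≡beyond : beyond 0 (a + b) a ≡ pair a b
  pair≡beyond = tri-beyond 0 (a + b) a
  enoughFuel : a + b ≤ beyond 0 (a + b) a
  enoughFuel = subst (a + b ≤_) (sym pair≡beyond) (≤-trans (n≤tri[n] (a + b)) (m≤m+n _ a))

fst-pair : ∀ a b → fst (pair a b) ≡ a
fst-pair a b = cong proj₁ (unpair-pair a b)

snd-pair : ∀ a b → snd (pair a b) ≡ b
snd-pair a b = cong proj₂ (unpair-pair a b)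

pair-injectiveˡ : ∀ {a b a′ b′} → pair a b ≡ pair a′ b′ → a ≡ a′
pair-injectiveˡ {a} {b} {a′} {b′} e = trans (sym (fst-pair a b)) (trans (cong fst e) (fst-pair a′ b′))

pair-injectiveʳ : ∀ {a b a′ b′} → pair a b ≡ pair a′ b′ → b ≡ b′
pair-injectiveʳ {a} {b} {a′} {b′} e = trans (sym (snd-pair a b)) (trans (cong snd e) (snd-pair a′ b′))

unpairAux-≤ : ∀ fuel w rem → let (x , y) = unpairAux fuel w rem in
              x ≤ tri w + rem × y ≤ tri w + rem
unpairAux-≤ zero w rem = m≤n+m rem (tri w) , ≤-trans (m∸n≤m w rem) (≤-trans (n≤tri[n] w) (m≤m+n _ rem))
unpairAux-≤ (suc f) w rem with rem ≤ᵇ w in eq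
... | true  = m≤n+m rem (tri w) , ≤-trans (m∸n≤m w rem) (≤-trans (n≤tri[n] w) (m≤m+n _ rem))
... | false = subst (λ z → let (x , y) = unpairAux f (suc w) (rem ∸ suc w) in x ≤ z × y ≤ z)
                    sameTotal (unpairAux-≤ f (suc w) (rem ∸ suc w))
  where
  sameTotal : tri (suc w) + (rem ∸ suc w) ≡ tri w + rem
  sameTotal = begin
    (suc w + tri w) + (rem ∸ suc w)  ≡⟨ cong (_+ (rem ∸ suc w)) (+-comm (suc w) (tri w)) ⟩
    (tri w + suc w) + (rem ∸ suc w)  ≡⟨ +-assoc (tri w) (suc w) _ ⟩
    tri w + (suc w + (rem ∸ suc w))  ≡⟨ cong (tri w +_) (m+[n∸m]≡n (≤ᵇ-false⇒> eq)) ⟩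
    tri w + rem                      ∎
    where open ≡-Reasoning

fst[n]≤n : ∀ n → fst n ≤ n
fst[n]≤n n = proj₁ (unpairAux-≤ n 0 n)

snd[n]≤n : ∀ n → snd n ≤ n
snd[n]≤n n = proj₂ (unpairAux-≤ n 0 n)

Realises : Baire → Code → (ℕ → ℕ) → Set
Realises f c F = Computes c f F

Realises₂ : Baire → Code → (ℕ → ℕ → ℕ) → Set
Realises₂ f c h = ∀ a b → Ev f c (pair a b) (h a b)

ev≡ : ∀ {f c x y y′} → Ev f c x y → y ≡ y′ → Ev f c x y′
ev≡ e refl = e

cConst : ℕ → Code
cConst zero    = cZ
cConst (suc n) = cComp cS (cConst n)

cConst-ev : ∀ {f} n x → Ev f (cConst n) x n
cConst-ev zero    x = ev-Z
cConst-ev (suc n) x = ev-Comp (cConst-ev n x) ev-S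

cFst-pair : ∀ {f} a b → Ev f cFst (pair a b) a
cFst-pair a b = ev≡ ev-Fst (fst-pair a b)

cSnd-pair : ∀ {f} a b → Ev f cSnd (pair a b) b
cSnd-pair a b = ev≡ ev-Snd (snd-pair a b)

cComp₂-correct : ∀ {f H c₁ c₂ h F₁ F₂} → Realises₂ f H h → Realises f c₁ F₁ → Realises f c₂ F₂ →
                 Realises f (cComp H (cPair c₁ c₂)) (λ x → h (F₁ x) (F₂ x))
cComp₂-correct eh e₁ e₂ x = ev-Comp (ev-Pair (e₁ x) (e₂ x)) (eh _ _)

cRec-correct : ∀ {f c d} (C : ℕ → ℕ) (D : ℕ → ℕ → ℕ → ℕ) (G : ℕ → ℕ → ℕ) →
  Realises f c C → (∀ a n y → Ev f d (pair a (pair n y)) (D a n y)) →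
  (∀ a → G a 0 ≡ C a) → (∀ a n → G a (suc n) ≡ D a n (G a n)) →
  Realises₂ f (cRec c d) G
cRec-correct {f} {c} {d} C D G ec ed G-zero G-suc a n =
  ev-Rec (subst₂ (λ a′ n′ → EvRec f c d a′ n′ (G a n)) (sym (fst-pair a n)) (sym (snd-pair a n)) (unfold n))
  where
  unfold : ∀ n → EvRec f c d a n (G a n)
  unfold zero    = rec-zero (ev≡ (ec a) (sym (G-zero a)))
  unfold (suc n) = rec-suc (unfold n) (ev≡ (ed a n (G a n)) (sym (G-suc a n)))

cFstSnd cSndSnd : Code
cFstSnd = cComp cFst cSnd
cSndSnd = cComp cSnd cSnd

cRec-step : ∀ {f c v} a n y → Ev f c y v → Ev f (cComp c cSndSnd) (pair a (pair n y)) v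
cRec-step a n y ec = ev-Comp (ev-Comp (cSnd-pair a (pair n y)) (cSnd-pair n y)) ec

cPred : Code
cPred = cComp (cRec cZ cFstSnd) (cPair cZ cI)

cPred-correct : ∀ {f} → Realises f cPred pred
cPred-correct x = ev-Comp (ev-Pair ev-Z ev-I)
  (cRec-correct (λ _ → 0) (λ _ n _ → n) (λ _ n → pred n) (λ _ → ev-Z)
    (λ a n y → ev-Comp (cSnd-pair a (pair n y)) (cFst-pair n y)) (λ _ → refl) (λ _ _ → refl) 0 x)

cMonus : Code
cMonus = cRec cI (cComp cPred cSndSnd)

cMonus-correct : ∀ {f} → Realises₂ f cMonus _∸_
cMonus-correct = cRec-correct (λ a → a) (λ _ _ y → pred y) _∸_ (λ _ → ev-I)
  (λ a n y → cRec-step a n y (cPred-correct y)) (λ _ → refl) (λ a n → sym (pred[m∸n]≡m∸[1+n] a n))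

cAdd : Code
cAdd = cRec cI (cComp cS cSndSnd)

cAdd-correct : ∀ {f} → Realises₂ f cAdd _+_
cAdd-correct = cRec-correct (λ a → a) (λ _ _ y → suc y) _+_ (λ _ → ev-I)
  (λ a n y → cRec-step a n y ev-S) +-identityʳ +-suc

ifZero : ℕ → ℕ → ℕ → ℕ
ifZero zero    x y = x
ifZero (suc _) x y = y

cIfZeroPair : Code
cIfZeroPair = cRec cFst (cComp cSnd cFst)

cIfZeroPair-correct : ∀ {f} → Realises₂ f cIfZeroPair (λ a b → ifZero b (fst a) (snd a))
cIfZeroPair-correct = cRec-correct fst (λ a _ _ → snd a) (λ a b → ifZero b (fst a) (snd a)) (λ _ → ev-Fst)
  (λ a n y → ev-Comp (cFst-pair a (pair n y)) ev-Snd) (λ _ → refl) (λ _ _ → refl)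

-- Both branches are evaluated, so both have to converge (compare cLazyIfZero).
cIfZero : Code → Code → Code → Code
cIfZero b x y = cComp cIfZeroPair (cPair (cPair x y) b)

cIfZero-ev : ∀ {f b x y z B X Y} → Ev f b z B → Ev f x z X → Ev f y z Y → Ev f (cIfZero b x y) z (ifZero B X Y)
cIfZero-ev {B = B} {X} {Y} eb ex ey =
  ev-Comp (ev-Pair (ev-Pair ex ey) eb)
    (ev≡ (cIfZeroPair-correct (pair X Y) B) (cong₂ (ifZero B) (fst-pair X Y) (snd-pair X Y)))

cIfZero-correct : ∀ {f b x y B X Y} → Realises f b B → Realises f x X → Realises f y Y →
                  Realises f (cIfZero b x y) (λ z → ifZero (B z) (X z) (Y z))
cIfZero-correct eb ex ey z = cIfZero-ev (eb z) (ex z) (ey z)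

sg : ℕ → ℕ
sg zero    = 0
sg (suc _) = 1

cSg : Code
cSg = cIfZero cI (cConst 0) (cConst 1)

cSg-correct : ∀ {f} → Realises f cSg sg
cSg-correct z = ev≡ (cIfZero-correct (λ _ → ev-I) (cConst-ev 0) (cConst-ev 1) z) (ifZero≡sg z)
  where
  ifZero≡sg : ∀ z → ifZero z 0 1 ≡ sg z
  ifZero≡sg zero    = refl
  ifZero≡sg (suc z) = refl

differ : ℕ → ℕ → ℕ
differ zero    zero    = 0
differ zero    (suc _) = 1
differ (suc _) zero    = 1
differ (suc a) (suc b) = differ a b

cDiffer : Code
cDiffer = cComp cSg (cComp cAdd (cPair cMonus (cComp cMonus (cPair cSnd cFst))))

cDiffer-correct : ∀ {f} → Realises₂ f cDiffer differ
cDiffer-correct a b =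
  ev-Comp (ev-Comp (ev-Pair (cMonus-correct a b) (ev-Comp (ev-Pair (cSnd-pair a b) (cFst-pair a b)) (cMonus-correct b a)))
                   (cAdd-correct (a ∸ b) (b ∸ a)))
          (ev≡ (cSg-correct _) (sg-distance a b))
  where
  sg-distance : ∀ a b → sg ((a ∸ b) + (b ∸ a)) ≡ differ a b
  sg-distance zero    zero    = refl
  sg-distance zero    (suc b) = refl
  sg-distance (suc a) zero    = refl
  sg-distance (suc a) (suc b) = sg-distance a b

differ-refl : ∀ a → differ a a ≡ 0
differ-refl zero    = refl
differ-refl (suc a) = differ-refl a

differ≡0⇒≡ : ∀ a b → differ a b ≡ 0 → a ≡ b
differ≡0⇒≡ zero    zero    _ = refl
differ≡0⇒≡ (suc a) (suc b) e = cong suc (differ≡0⇒≡ a b e)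

≢⇒differ≡1 : ∀ a b → a ≢ b → differ a b ≡ 1
≢⇒differ≡1 zero    zero    a≢b = ⊥-elim (a≢b refl)
≢⇒differ≡1 zero    (suc b) _   = refl
≢⇒differ≡1 (suc a) zero    _   = refl
≢⇒differ≡1 (suc a) (suc b) a≢b = ≢⇒differ≡1 a b (λ e → a≢b (cong suc e))


[r+q*d]%d≡r : ∀ {r} q d .{{_ : NonZero d}} → r < d → (r + q * d) % d ≡ r
[r+q*d]%d≡r {r} q d r<d = trans ([m+kn]%n≡m%n r q d) (m<n⇒m%n≡m r<d)

[r+q*d]/d≡q : ∀ {r} q d .{{_ : NonZero d}} → r < d → (r + q * d) / d ≡ q
[r+q*d]/d≡q {r} q d r<d = begin
  (r + q * d) / d      ≡⟨ +-distrib-/ r (q * d) remainders<d ⟩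
  r / d + q * d / d    ≡⟨ cong₂ _+_ (m<n⇒m/n≡0 r<d) (m*n/n≡m q d) ⟩
  q                    ∎
  where
  open ≡-Reasoning
  remainders<d : r % d + (q * d) % d < d
  remainders<d = subst₂ (λ a b → a + b < d) (sym (m<n⇒m%n≡m r<d)) (sym (m*n%n≡0 q d))
                        (subst (_< d) (sym (+-identityʳ r)) r<d)

-- Primitive recursion can only count, so quotient and remainder by suc b are
-- obtained by counting up to n with a (quotient , remainder) counter.
countStep : ℕ → ℕ → ℕ
countStep b y = ifZero (differ (snd y) b) (pair (suc (fst y)) 0) (pair (fst y) (suc (snd y)))

count : ℕ → ℕ → ℕ
count b zero    = pair 0 0
count b (suc n) = countStep b (count b n)

count-invariant : ∀ b n → Σ ℕ λ q → Σ ℕ λ r → count b n ≡ pair q r × r < suc b × r + q * suc b ≡ n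
count-invariant b zero = 0 , 0 , refl , s≤s z≤n , refl
count-invariant b (suc n) with count-invariant b n
... | q , r , eq , r<d , total rewrite eq | fst-pair q r | snd-pair q r with differ r b in r≟b
... | zero  = suc q , 0 , refl , s≤s z≤n , carry
  where
  carry : suc q * suc b ≡ suc n
  carry rewrite differ≡0⇒≡ r b r≟b = cong suc total
... | suc _ = q , suc r , refl , s≤s (≤∧≢⇒< (s≤s⁻¹ r<d) r≢b) , cong suc total
  where
  r≢b : r ≢ b
  r≢b refl = 0≢1+n (trans (sym (differ-refl r)) r≟b)

count≡pair[/,%] : ∀ b n → count b n ≡ pair (n / suc b) (n % suc b)
count≡pair[/,%] b n with count-invariant b n
... | q , r , eq , r<d , refl = trans eq (cong₂ pair (sym ([r+q*d]/d≡q q (suc b) r<d)) (sym ([r+q*d]%d≡r q (suc b) r<d)))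

cCountStep : ℕ → Code
cCountStep b = cIfZero (cComp cDiffer (cPair cSnd (cConst b)))
                       (cPair (cComp cS cFst) cZ) (cPair cFst (cComp cS cSnd))

cCountStep-correct : ∀ {f} b → Realises f (cCountStep b) (countStep b)
cCountStep-correct b = cIfZero-correct (cComp₂-correct cDiffer-correct (λ _ → ev-Snd) (cConst-ev b))
  (λ _ → ev-Pair (ev-Comp ev-Fst ev-S) ev-Z) (λ _ → ev-Pair ev-Fst (ev-Comp ev-Snd ev-S))

cCount : ℕ → Code
cCount b = cComp (cRec (cPair cZ cZ) (cComp (cCountStep b) cSndSnd)) (cPair cZ cI)

cCount-correct : ∀ {f} b → Realises f (cCount b) (count b)
cCount-correct b n = ev-Comp (ev-Pair ev-Z ev-I)
  (cRec-correct (λ _ → pair 0 0) (λ _ _ y → countStep b y) (λ _ n → count b n) (λ _ → ev-Pair ev-Z ev-Z)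
    (λ a n y → cRec-step a n y (cCountStep-correct b y))
    (λ _ → refl) (λ _ _ → refl) 0 n)

cDivBy cModBy : ℕ → Code
cDivBy b = cComp cFst (cCount b)
cModBy b = cComp cSnd (cCount b)

cDivBy-correct : ∀ {f} b → Realises f (cDivBy b) (_/ suc b)
cDivBy-correct b n = ev-Comp (cCount-correct b n)
  (ev≡ ev-Fst (trans (cong fst (count≡pair[/,%] b n)) (fst-pair (n / suc b) (n % suc b))))

cModBy-correct : ∀ {f} b → Realises f (cModBy b) (_% suc b)
cModBy-correct b n = ev-Comp (cCount-correct b n)
  (ev≡ ev-Snd (trans (cong snd (count≡pair[/,%] b n)) (snd-pair (n / suc b) (n % suc b))))

decodeTag : ℕ → Code → Code → Code → Code
decodeTag 0 p q r = cZ
decodeTag 1 p q r = cS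
decodeTag 2 p q r = cI
decodeTag 3 p q r = cO
decodeTag 4 p q r = cFst
decodeTag 5 p q r = cSnd
decodeTag 6 p q r = cPair p q
decodeTag 7 p q r = cComp p q
decodeTag 8 p q r = cRec p q
decodeTag (suc (suc (suc (suc (suc (suc (suc (suc (suc _))))))))) p q r = cMu r

decodeTag-cong : ∀ t {p p′ q q′ r r′} → p ≡ p′ → q ≡ q′ → r ≡ r′ →
                 decodeTag t p q r ≡ decodeTag t p′ q′ r′
decodeTag-cong t refl refl refl = refl

decodeF-suc : ∀ fuel n → decodeF (suc fuel) n ≡
  decodeTag (n % 10) (decodeF fuel (fst (n / 10))) (decodeF fuel (snd (n / 10))) (decodeF fuel (n / 10))
decodeF-suc fuel n with n % 10
... | 0 = refl
... | 1 = refl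
... | 2 = refl
... | 3 = refl
... | 4 = refl
... | 5 = refl
... | 6 = refl
... | 7 = refl
... | 8 = refl
... | suc (suc (suc (suc (suc (suc (suc (suc (suc _)))))))) = refl

≤[1+m]/10⇒< : ∀ {x} m f → x ≤ suc m / 10 → suc m ≤ f → x < f
≤[1+m]/10⇒< m f x≤ m<f = ≤-<-trans x≤ (≤-trans (m/n<m (suc m) 10 (s≤s (s≤s z≤n))) m<f)

decodeF-stable : ∀ f₁ f₂ n → n < f₁ → n < f₂ → decodeF f₁ n ≡ decodeF f₂ n
decodeF-stable (suc f₁) (suc f₂) zero    _ _ = refl
decodeF-stable (suc f₁) (suc f₂) (suc m) (s≤s m<f₁) (s≤s m<f₂) = begin
  decodeF (suc f₁) (suc m)  ≡⟨ decodeF-suc f₁ (suc m) ⟩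
  decodeTag (suc m % 10) _ _ _
    ≡⟨ decodeTag-cong (suc m % 10) (stable (fst[n]≤n _)) (stable (snd[n]≤n _)) (stable ≤-refl) ⟩
  decodeTag (suc m % 10) _ _ _  ≡⟨ sym (decodeF-suc f₂ (suc m)) ⟩
  decodeF (suc f₂) (suc m)  ∎
  where
  open ≡-Reasoning
  stable : ∀ {x} → x ≤ suc m / 10 → decodeF f₁ x ≡ decodeF f₂ x
  stable x≤ = decodeF-stable f₁ f₂ _ (≤[1+m]/10⇒< m f₁ x≤ m<f₁) (≤[1+m]/10⇒< m f₂ x≤ m<f₂)

decode-unfold : ∀ e → decode e ≡ decodeTag (e % 10) (decode (fst (e / 10))) (decode (snd (e / 10))) (decode (e / 10))
decode-unfold zero    = refl
decode-unfold (suc m) = trans (decodeF-suc (suc m) (suc m))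
  (decodeTag-cong (suc m % 10) (stable (fst[n]≤n _)) (stable (snd[n]≤n _)) (stable ≤-refl))
  where
  stable : ∀ {x} → x ≤ suc m / 10 → decodeF (suc m) x ≡ decode x
  stable {x} x≤ = decodeF-stable (suc m) (suc x) _ (≤[1+m]/10⇒< m (suc m) x≤ ≤-refl) ≤-refl

decode-tagged : ∀ {n} t k → t < 10 → n ≡ t + k * 10 →
                decode n ≡ decodeTag t (decode (fst k)) (decode (snd k)) (decode k)
decode-tagged {n} t k t<10 refl = trans (decode-unfold n)
  (cong₂ (λ t′ k′ → decodeTag t′ (decode (fst k′)) (decode (snd k′)) (decode k′))
         ([r+q*d]%d≡r k 10 t<10) ([r+q*d]/d≡q k 10 t<10))

decode-binary : ∀ {n} t {p q c d} → t < 10 → n ≡ t + pair p q * 10 → decode p ≡ c → decode q ≡ d →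
                decode n ≡ decodeTag t c d (decode (pair p q))
decode-binary t {p} {q} t<10 n≡ refl refl = trans (decode-tagged t (pair p q) t<10 n≡)
  (cong₂ (λ a b → decodeTag t a b (decode (pair p q))) (cong decode (fst-pair p q)) (cong decode (snd-pair p q)))

-- Kept abstract so that the numerals encode c are never unfolded by the type checker.
abstract
  encode : Code → ℕ
  encode cZ          = 0
  encode cS          = 1
  encode cI          = 2
  encode cO          = 3
  encode cFst        = 4
  encode cSnd        = 5
  encode (cPair c d) = 6 + pair (encode c) (encode d) * 10
  encode (cComp c d) = 7 + pair (encode c) (encode d) * 10
  encode (cRec c d)  = 8 + pair (encode c) (encode d) * 10
  encode (cMu c)     = 9 + encode c * 10

  decode-encode : ∀ c → decode (encode c) ≡ c
  decode-encode cZ          = refl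
  decode-encode cS          = refl
  decode-encode cI          = refl
  decode-encode cO          = refl
  decode-encode cFst        = refl
  decode-encode cSnd        = refl
  decode-encode (cPair c d) = decode-binary 6 (<ᵇ⇒< 6 10 _) refl (decode-encode c) (decode-encode d)
  decode-encode (cComp c d) = decode-binary 7 (<ᵇ⇒< 7 10 _) refl (decode-encode c) (decode-encode d)
  decode-encode (cRec c d)  = decode-binary 8 (<ᵇ⇒< 8 10 _) refl (decode-encode c) (decode-encode d)
  decode-encode (cMu c)     = trans (decode-tagged 9 (encode c) (<ᵇ⇒< 9 10 _) refl) (cong cMu (decode-encode c))


-- A little language for the unary functions the universal machine needs; call c G e
-- stands for G applied to e, computed by the code c.
data Expr : Set where
  input : Expr
  lit : ℕ → Expr
  fstE sndE sucE predE modE divE : Expr → Expr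
  pairE differE : Expr → Expr → Expr
  ifzE : Expr → Expr → Expr → Expr
  call : Code → (ℕ → ℕ) → Expr → Expr
  compE : Expr → Expr → Expr

compile : Expr → Code
compile input = cI
compile (lit n) = cConst n
compile (fstE e) = cComp cFst (compile e)
compile (sndE e) = cComp cSnd (compile e)
compile (sucE e) = cComp cS (compile e)
compile (predE e) = cComp cPred (compile e)
compile (modE e) = cComp (cModBy 9) (compile e)
compile (divE e) = cComp (cDivBy 9) (compile e)
compile (pairE a b) = cPair (compile a) (compile b)
compile (differE a b) = cComp cDiffer (cPair (compile a) (compile b))
compile (ifzE a b c) = cIfZero (compile a) (compile b) (compile c)
compile (call c G e) = cComp c (compile e)
compile (compE a b) = cComp (compile a) (compile b)

evalExpr : Expr → ℕ → ℕ
evalExpr input z = z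
evalExpr (lit n) z = n
evalExpr (fstE e) z = fst (evalExpr e z)
evalExpr (sndE e) z = snd (evalExpr e z)
evalExpr (sucE e) z = suc (evalExpr e z)
evalExpr (predE e) z = pred (evalExpr e z)
evalExpr (modE e) z = evalExpr e z % 10
evalExpr (divE e) z = evalExpr e z / 10
evalExpr (pairE a b) z = pair (evalExpr a z) (evalExpr b z)
evalExpr (differE a b) z = differ (evalExpr a z) (evalExpr b z)
evalExpr (ifzE a b c) z = ifZero (evalExpr a z) (evalExpr b z) (evalExpr c z)
evalExpr (call c G e) z = G (evalExpr e z)
evalExpr (compE a b) z = evalExpr a (evalExpr b z)

CallsRealised : Baire → Expr → Set
CallsRealised f input = ⊤
CallsRealised f (lit n) = ⊤
CallsRealised f (fstE e) = CallsRealised f e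
CallsRealised f (sndE e) = CallsRealised f e
CallsRealised f (sucE e) = CallsRealised f e
CallsRealised f (predE e) = CallsRealised f e
CallsRealised f (modE e) = CallsRealised f e
CallsRealised f (divE e) = CallsRealised f e
CallsRealised f (pairE a b) = CallsRealised f a × CallsRealised f b
CallsRealised f (differE a b) = CallsRealised f a × CallsRealised f b
CallsRealised f (ifzE a b c) = CallsRealised f a × CallsRealised f b × CallsRealised f c
CallsRealised f (call c G e) = Realises f c G × CallsRealised f e
CallsRealised f (compE a b) = CallsRealised f a × CallsRealised f b

compile-correct : ∀ {f} e → CallsRealised f e → Realises f (compile e) (evalExpr e)
compile-correct input g z = ev-I
compile-correct (lit n) g z = cConst-ev n z
compile-correct (fstE e) g z = ev-Comp (compile-correct e g z) ev-Fst
compile-correct (sndE e) g z = ev-Comp (compile-correct e g z) ev-Snd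
compile-correct (sucE e) g z = ev-Comp (compile-correct e g z) ev-S
compile-correct (predE e) g z = ev-Comp (compile-correct e g z) (cPred-correct _)
compile-correct (modE e) g z = ev-Comp (compile-correct e g z) (cModBy-correct 9 _)
compile-correct (divE e) g z = ev-Comp (compile-correct e g z) (cDivBy-correct 9 _)
compile-correct (pairE a b) (ga , gb) z = ev-Pair (compile-correct a ga z) (compile-correct b gb z)
compile-correct (differE a b) (ga , gb) = cComp₂-correct cDiffer-correct (compile-correct a ga) (compile-correct b gb)
compile-correct (ifzE a b c) (ga , gb , gc) = cIfZero-correct (compile-correct a ga) (compile-correct b gb) (compile-correct c gc)
compile-correct (call c G e) (gc , ge) z = ev-Comp (compile-correct e ge z) (gc _)
compile-correct (compE a b) (ga , gb) z = ev-Comp (compile-correct b gb z) (compile-correct a ga _)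


-- The universal functional runs an abstract machine on numbers.  The state
-- evalState e x κ evaluates the program with index e on x under the stack κ,
-- and returnState v κ hands v to the top frame of κ; the machine halts in
-- returnState v 0.  The tag of a frame says what waits for the value:
-- 0 and 1 the two halves of cPair, 2 cComp, 3 cRec (with counter pair i n)
-- and 4 cMu (at candidate z).
evalState : ℕ → ℕ → ℕ → ℕ
evalState e x κ = pair 0 (pair e (pair x κ))

returnState : ℕ → ℕ → ℕ
returnState v κ = pair 1 (pair v (pair 0 κ))

push : ℕ → ℕ → ℕ
push fr κ = suc (pair fr κ)

frame : ℕ → ℕ → ℕ → ℕ → ℕ
frame t u w z = pair t (pair u (pair w z))

evalStateE : Expr → Expr → Expr → Expr
evalStateE e x κ = pairE (lit 0) (pairE e (pairE x κ))

returnStateE : Expr → Expr → Expr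
returnStateE v κ = pairE (lit 1) (pairE v (pairE (lit 0) κ))

pushE : Expr → Expr → Expr
pushE fr κ = sucE (pairE fr κ)

frameE : ℕ → Expr → Expr → Expr → Expr
frameE t u w z = pairE (lit t) (pairE u (pairE w z))

caseList : ℕ → List ℕ → ℕ → ℕ
caseList t []       d = d
caseList t (v ∷ vs) d = ifZero t v (caseList (pred t) vs d)

casesE : Expr → List Expr → Expr → Expr
casesE t []       d = d
casesE t (b ∷ bs) d = ifzE t b (casesE (predE t) bs d)

AllCallsRealised : Baire → List Expr → Set
AllCallsRealised f []       = ⊤
AllCallsRealised f (b ∷ bs) = CallsRealised f b × AllCallsRealised f bs

casesE-realised : ∀ {f} t bs d → CallsRealised f t → AllCallsRealised f bs → CallsRealised f d →
                  CallsRealised f (casesE t bs d)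
casesE-realised t []       d _  _          rd = rd
casesE-realised t (b ∷ bs) d rt (rb , rbs) rd = rt , rb , casesE-realised (predE t) bs d rt rbs rd

data CodeShape (t : ℕ) (p q r : Code) : Code → Set where
  shape-Z    : t ≡ 0 → CodeShape t p q r cZ
  shape-S    : t ≡ 1 → CodeShape t p q r cS
  shape-I    : t ≡ 2 → CodeShape t p q r cI
  shape-O    : t ≡ 3 → CodeShape t p q r cO
  shape-Fst  : t ≡ 4 → CodeShape t p q r cFst
  shape-Snd  : t ≡ 5 → CodeShape t p q r cSnd
  shape-Pair : t ≡ 6 → CodeShape t p q r (cPair p q)
  shape-Comp : t ≡ 7 → CodeShape t p q r (cComp p q)
  shape-Rec  : t ≡ 8 → CodeShape t p q r (cRec p q)
  shape-Mu   : ∀ k → t ≡ 9 + k → CodeShape t p q r (cMu r)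

decodeTag-shape : ∀ t p q r → CodeShape t p q r (decodeTag t p q r)
decodeTag-shape 0 p q r = shape-Z refl
decodeTag-shape 1 p q r = shape-S refl
decodeTag-shape 2 p q r = shape-I refl
decodeTag-shape 3 p q r = shape-O refl
decodeTag-shape 4 p q r = shape-Fst refl
decodeTag-shape 5 p q r = shape-Snd refl
decodeTag-shape 6 p q r = shape-Pair refl
decodeTag-shape 7 p q r = shape-Comp refl
decodeTag-shape 8 p q r = shape-Rec refl
decodeTag-shape (suc (suc (suc (suc (suc (suc (suc (suc (suc k))))))))) p q r = shape-Mu k refl

decode-shape : ∀ e → CodeShape (e % 10) (decode (fst (e / 10))) (decode (snd (e / 10))) (decode (e / 10)) (decode e)
decode-shape e = subst (CodeShape (e % 10) _ _ _) (sym (decode-unfold e)) (decodeTag-shape (e % 10) _ _ _)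

-- Q is a code realising the oracle G of the simulated computations.
module Machine (Q : Code) (G : ℕ → ℕ) where

  eE xE κE tagE bodyE leftE rightE : Expr
  eE     = fstE input
  xE     = fstE (sndE input)
  κE     = sndE (sndE input)
  tagE   = modE eE
  bodyE  = divE eE
  leftE  = fstE bodyE
  rightE = sndE bodyE

  evalCases : List Expr
  evalCases = returnStateE (lit 0) κE
            ∷ returnStateE (sucE xE) κE
            ∷ returnStateE xE κE
            ∷ returnStateE (call Q G xE) κE
            ∷ returnStateE (fstE xE) κE
            ∷ returnStateE (sndE xE) κE
            ∷ evalStateE leftE xE (pushE (frameE 0 rightE xE (lit 0)) κE)
            ∷ evalStateE rightE xE (pushE (frameE 2 leftE (lit 0) (lit 0)) κE)
            ∷ evalStateE leftE (fstE xE) (pushE (frameE 3 rightE (fstE xE) (pairE (lit 0) (sndE xE))) κE)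
            ∷ []

  evalMu : Expr
  evalMu = evalStateE bodyE (pairE xE (lit 0)) (pushE (frameE 4 bodyE xE (lit 0)) κE)

  evalStepE : Expr
  evalStepE = casesE tagE evalCases evalMu

  frameStepE : Expr
  frameStepE = casesE tE
      ( evalStateE uE wE (pushE (frameE 1 vE (lit 0) (lit 0)) κ′E)
      ∷ returnStateE (pairE uE vE) κ′E
      ∷ evalStateE uE vE κ′E
      ∷ ifzE (differE (fstE zE) (sndE zE)) (returnStateE vE κ′E)
          (evalStateE uE (pairE wE (pairE (fstE zE) vE)) (pushE (frameE 3 uE wE (pairE (sucE (fstE zE)) (sndE zE))) κ′E))
      ∷ [])
      (ifzE vE (returnStateE zE κ′E) (evalStateE uE (pairE wE (sucE zE)) (pushE (frameE 4 uE wE (sucE zE)) κ′E)))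
    where
    vE κ′E tE uE wE zE : Expr
    vE  = fstE (fstE input)
    κ′E = sndE (fstE input)
    tE  = fstE (sndE input)
    uE  = fstE (sndE (sndE input))
    wE  = fstE (sndE (sndE (sndE input)))
    zE  = sndE (sndE (sndE (sndE input)))

  returnStepE : Expr
  returnStepE = ifzE κR (returnStateE vR (lit 0))
                        (compE frameStepE (pairE (pairE vR (sndE (predE κR))) (fstE (predE κR))))
    where
    vR κR : Expr
    vR = fstE input
    κR = sndE (sndE input)

  stepE : Expr
  stepE = ifzE (fstE input) (compE evalStepE (sndE input)) (compE returnStepE (sndE input))

  stepE-realised : ∀ {f} → Realises f Q G → CallsRealised f stepE
  stepE-realised hQ = _ , (casesE-realised tagE evalCases evalMu _ (_ , _ , _ , (_ , (hQ , _) , _) , _) _ , _) , _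

  -- abstract, so that step never unfolds into the (large) normal form of stepE.
  abstract
    step : ℕ → ℕ
    step = evalExpr stepE

    step≡evalExpr : ∀ s → step s ≡ evalExpr stepE s
    step≡evalExpr s = refl

    step-unfold : ∀ s → step s ≡ ifZero (fst s) (evalExpr evalStepE (snd s)) (evalExpr returnStepE (snd s))
    step-unfold s = refl

  evalSuccessor : ℕ → ℕ → ℕ → ℕ → ℕ
  evalSuccessor t e x κ = caseList t
     ( returnState 0 κ ∷ returnState (suc x) κ ∷ returnState x κ ∷ returnState (G x) κ
     ∷ returnState (fst x) κ ∷ returnState (snd x) κ
     ∷ evalState (fst (e / 10)) x (push (frame 0 (snd (e / 10)) x 0) κ)
     ∷ evalState (snd (e / 10)) x (push (frame 2 (fst (e / 10)) 0 0) κ)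
     ∷ evalState (fst (e / 10)) (fst x) (push (frame 3 (snd (e / 10)) (fst x) (pair 0 (snd x))) κ)
     ∷ [])
     (evalState (e / 10) (pair x 0) (push (frame 4 (e / 10) x 0) κ))

  frameSuccessor : ℕ → ℕ → ℕ → ℕ → ℕ → ℕ → ℕ
  frameSuccessor v κ t u w z = caseList t
     ( evalState u w (push (frame 1 v 0 0) κ)
     ∷ returnState (pair u v) κ
     ∷ evalState u v κ
     ∷ ifZero (differ (fst z) (snd z)) (returnState v κ)
              (evalState u (pair w (pair (fst z) v)) (push (frame 3 u w (pair (suc (fst z)) (snd z))) κ))
     ∷ [])
     (ifZero v (returnState z κ) (evalState u (pair w (suc z)) (push (frame 4 u w (suc z)) κ)))

  evalStepE-meaning : ∀ τ → evalExpr evalStepE τ ≡ evalSuccessor (fst τ % 10) (fst τ) (fst (snd τ)) (snd (snd τ))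
  evalStepE-meaning τ = refl

  returnStepE-meaning : ∀ τ → evalExpr returnStepE τ ≡
    ifZero (snd (snd τ)) (returnState (fst τ) 0)
           (evalExpr frameStepE (pair (pair (fst τ) (snd (pred (snd (snd τ))))) (fst (pred (snd (snd τ))))))
  returnStepE-meaning τ = refl

  step-evalState : ∀ {t} e x κ → e % 10 ≡ t → step (evalState e x κ) ≡ evalSuccessor t e x κ
  step-evalState e x κ refl = begin
    step (evalState e x κ)
      ≡⟨ step-unfold (evalState e x κ) ⟩
    ifZero (fst (pair 0 τ)) (evalExpr evalStepE (snd (pair 0 τ))) (evalExpr returnStepE (snd (pair 0 τ)))
      ≡⟨ cong₂ (λ u T′ → ifZero u (evalExpr evalStepE T′) (evalExpr returnStepE T′)) (fst-pair 0 τ) (snd-pair 0 τ) ⟩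
    evalExpr evalStepE τ
      ≡⟨ evalStepE-meaning τ ⟩
    evalSuccessor (fst τ % 10) (fst τ) (fst (snd τ)) (snd (snd τ))
      ≡⟨ cong₂ (λ e′ y → evalSuccessor (e′ % 10) e′ (fst y) (snd y)) (fst-pair e (pair x κ)) (snd-pair e (pair x κ)) ⟩
    evalSuccessor (e % 10) e (fst (pair x κ)) (snd (pair x κ))
      ≡⟨ cong₂ (evalSuccessor (e % 10) e) (fst-pair x κ) (snd-pair x κ) ⟩
    evalSuccessor (e % 10) e x κ ∎
    where
    open ≡-Reasoning
    τ : ℕ
    τ = pair e (pair x κ)

  returnSuccessor : ℕ → ℕ → ℕ
  returnSuccessor v κ = ifZero κ (returnState v 0) (evalExpr frameStepE (pair (pair v (snd (pred κ))) (fst (pred κ))))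

  returnSuccessor-projections : ∀ v κ →
    returnSuccessor (fst (pair v (pair 0 κ))) (snd (snd (pair v (pair 0 κ)))) ≡ returnSuccessor v κ
  returnSuccessor-projections v κ =
    cong₂ returnSuccessor (fst-pair v (pair 0 κ)) (trans (cong snd (snd-pair v (pair 0 κ))) (snd-pair 0 κ))

  step-returnState : ∀ v κ → step (returnState v κ) ≡ returnSuccessor v κ
  step-returnState v κ = trans (step-unfold (returnState v κ))
    (trans (cong₂ (λ u τ → ifZero u (evalExpr evalStepE τ) (evalExpr returnStepE τ))
                  (fst-pair 1 (pair v (pair 0 κ))) (snd-pair 1 (pair v (pair 0 κ))))
           (returnSuccessor-projections v κ))

  step-halted : ∀ v → step (returnState v 0) ≡ returnState v 0
  step-halted v = step-returnState v 0

  frame-projections : ∀ {A : Set} (F : ℕ → ℕ → ℕ → ℕ → ℕ → ℕ → A) v κ t u w z →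
    F (fst (fst (pair (pair v κ) (frame t u w z)))) (snd (fst (pair (pair v κ) (frame t u w z))))
      (fst (snd (pair (pair v κ) (frame t u w z)))) (fst (snd (snd (pair (pair v κ) (frame t u w z)))))
      (fst (snd (snd (snd (pair (pair v κ) (frame t u w z))))))
      (snd (snd (snd (snd (pair (pair v κ) (frame t u w z))))))
    ≡ F v κ t u w z
  frame-projections F v κ t u w z
    rewrite fst-pair (pair v κ) (frame t u w z) | snd-pair (pair v κ) (frame t u w z)
          | fst-pair v κ | snd-pair v κ | fst-pair t (pair u (pair w z)) | snd-pair t (pair u (pair w z))
          | fst-pair u (pair w z) | snd-pair u (pair w z) | fst-pair w z | snd-pair w z = refl

  step-frame : ∀ v κ t u w z → step (returnState v (push (frame t u w z) κ)) ≡ frameSuccessor v κ t u w z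
  step-frame v κ t u w z = trans (step-returnState v (push (frame t u w z) κ))
    (trans (cong₂ (λ κ′ F → evalExpr frameStepE (pair (pair v κ′) F))
                  (snd-pair (frame t u w z) κ) (fst-pair (frame t u w z) κ))
           (frame-projections frameSuccessor v κ t u w z))

  step-frame-rec : ∀ v κ u w i n → step (returnState v (push (frame 3 u w (pair i n)) κ)) ≡
    ifZero (differ i n) (returnState v κ) (evalState u (pair w (pair i v)) (push (frame 3 u w (pair (suc i) n)) κ))
  step-frame-rec v κ u w i n = trans (step-frame v κ 3 u w (pair i n))
    (cong₂ (λ i′ n′ → ifZero (differ i′ n′) (returnState v κ)
                             (evalState u (pair w (pair i′ v)) (push (frame 3 u w (pair (suc i′) n′)) κ)))
           (fst-pair i n) (snd-pair i n))

  step-rec-done : ∀ v κ u w n → step (returnState v (push (frame 3 u w (pair n n)) κ)) ≡ returnState v κ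
  step-rec-done v κ u w n = trans (step-frame-rec v κ u w n n)
    (cong (λ b → ifZero b (returnState v κ) (evalState u (pair w (pair n v)) (push (frame 3 u w (pair (suc n) n)) κ)))
          (differ-refl n))

  step-rec-next : ∀ v κ u w i n → i ≢ n → step (returnState v (push (frame 3 u w (pair i n)) κ)) ≡
    evalState u (pair w (pair i v)) (push (frame 3 u w (pair (suc i) n)) κ)
  step-rec-next v κ u w i n i≢n = trans (step-frame-rec v κ u w i n)
    (cong (λ b → ifZero b (returnState v κ) (evalState u (pair w (pair i v)) (push (frame 3 u w (pair (suc i) n)) κ)))
          (≢⇒differ≡1 i n i≢n))

  Step : ℕ → ℕ → Set
  Step s s′ = step s ≡ s′

  _↝_ : ℕ → ℕ → Set
  _↝_ = Star Step

  steps : ℕ → ℕ → ℕ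
  steps zero    s = s
  steps (suc n) s = step (steps n s)

  steps-+ : ∀ n m s → steps (n + m) s ≡ steps n (steps m s)
  steps-+ zero    m s = refl
  steps-+ (suc n) m s = cong step (steps-+ n m s)

  ↝⇒steps : ∀ {s s′} → s ↝ s′ → Σ ℕ λ n → steps n s ≡ s′
  ↝⇒steps ε = 0 , refl
  ↝⇒steps {s} (refl ◅ r) with ↝⇒steps r
  ... | n , steps≡ = n + 1 , trans (steps-+ n 1 s) steps≡

  evaluates : ∀ {c x y} → Ev G c x y → ∀ e κ → decode e ≡ c → evalState e x κ ↝ returnState y κ
  evaluatesRec : ∀ {c d a j v} → EvRec G c d a j v → ∀ p q κ n → decode p ≡ c → decode q ≡ d → j ≤ n →
    evalState p a (push (frame 3 q a (pair 0 n)) κ) ↝ returnState v (push (frame 3 q a (pair j n)) κ)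
  evaluatesMu : ∀ {c x m y} → EvMu G c x m y → ∀ r κ → decode r ≡ c →
    evalState r (pair x m) (push (frame 4 r x m) κ) ↝ returnState y κ

  evaluates {x = x} ev e κ decode≡ = byShape ev (subst (CodeShape (e % 10) (decode p) (decode q) (decode (e / 10))) decode≡ (decode-shape e))
    where
    p q : ℕ
    p = fst (e / 10)
    q = snd (e / 10)
    byShape : ∀ {c y} → Ev G c x y → CodeShape (e % 10) (decode p) (decode q) (decode (e / 10)) c →
              evalState e x κ ↝ returnState y κ
    byShape ev-Z   (shape-Z t)   = step-evalState e x κ t ◅ ε
    byShape ev-S   (shape-S t)   = step-evalState e x κ t ◅ ε
    byShape ev-I   (shape-I t)   = step-evalState e x κ t ◅ ε
    byShape ev-O   (shape-O t)   = step-evalState e x κ t ◅ ε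
    byShape ev-Fst (shape-Fst t) = step-evalState e x κ t ◅ ε
    byShape ev-Snd (shape-Snd t) = step-evalState e x κ t ◅ ε
    byShape (ev-Pair {y = y} {z} e₁ e₂) (shape-Pair t) = begin
      evalState e x κ                          ⟶⟨ step-evalState e x κ t ⟩
      evalState p x (push (frame 0 q x 0) κ)   ⟶*⟨ evaluates e₁ p _ refl ⟩
      returnState y (push (frame 0 q x 0) κ)   ⟶⟨ step-frame y κ 0 q x 0 ⟩
      evalState q x (push (frame 1 y 0 0) κ)   ⟶*⟨ evaluates e₂ q _ refl ⟩
      returnState z (push (frame 1 y 0 0) κ)   ⟶⟨ step-frame z κ 1 y 0 0 ⟩
      returnState (pair y z) κ                 ∎
      where open StarReasoning Step
    byShape (ev-Comp {y = y} {z} e₁ e₂) (shape-Comp t) = begin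
      evalState e x κ                          ⟶⟨ step-evalState e x κ t ⟩
      evalState q x (push (frame 2 p 0 0) κ)   ⟶*⟨ evaluates e₁ q _ refl ⟩
      returnState y (push (frame 2 p 0 0) κ)   ⟶⟨ step-frame y κ 2 p 0 0 ⟩
      evalState p y κ                          ⟶*⟨ evaluates e₂ p κ refl ⟩
      returnState z κ                          ∎
      where open StarReasoning Step
    byShape {y = y} (ev-Rec er) (shape-Rec t) = begin
      evalState e x κ                                                    ⟶⟨ step-evalState e x κ t ⟩
      evalState p (fst x) (push (frame 3 q (fst x) (pair 0 (snd x))) κ)  ⟶*⟨ evaluatesRec er p q κ (snd x) refl refl ≤-refl ⟩
      returnState y (push (frame 3 q (fst x) (pair (snd x) (snd x))) κ)  ⟶⟨ step-rec-done y κ q (fst x) (snd x) ⟩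
      returnState y κ                                                    ∎
      where open StarReasoning Step
    byShape {y = y} (ev-Mu em) (shape-Mu k t) = begin
      evalState e x κ                                              ⟶⟨ step-evalState e x κ t ⟩
      evalState (e / 10) (pair x 0) (push (frame 4 (e / 10) x 0) κ)  ⟶*⟨ evaluatesMu em (e / 10) κ refl ⟩
      returnState y κ                                              ∎
      where open StarReasoning Step

  evaluatesRec {a = a} (rec-zero ec) p q κ n refl refl _ = evaluates ec p _ refl
  evaluatesRec {a = a} (rec-suc {n = j} {y = v} {z} er ed) p q κ n refl refl j<n = begin
    evalState p a (push (frame 3 q a (pair 0 n)) κ)
      ⟶*⟨ evaluatesRec er p q κ n refl refl (≤-trans (n≤1+n j) j<n) ⟩
    returnState v (push (frame 3 q a (pair j n)) κ)
      ⟶⟨ step-rec-next v κ q a j n (λ { refl → <-irrefl refl j<n }) ⟩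
    evalState q (pair a (pair j v)) (push (frame 3 q a (pair (suc j) n)) κ)
      ⟶*⟨ evaluates ed q _ refl ⟩
    returnState z (push (frame 3 q a (pair (suc j) n)) κ) ∎
    where open StarReasoning Step

  evaluatesMu {x = x} (mu-found {m} ec) r κ refl = begin
    evalState r (pair x m) (push (frame 4 r x m) κ)  ⟶*⟨ evaluates ec r _ refl ⟩
    returnState 0 (push (frame 4 r x m) κ)           ⟶⟨ step-frame 0 κ 4 r x m ⟩
    returnState m κ                                  ∎
    where open StarReasoning Step
  evaluatesMu {x = x} {y = y} (mu-next {m} {k} ec em) r κ refl = begin
    evalState r (pair x m) (push (frame 4 r x m) κ)              ⟶*⟨ evaluates ec r _ refl ⟩
    returnState (suc k) (push (frame 4 r x m) κ)                 ⟶⟨ step-frame (suc k) κ 4 r x m ⟩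
    evalState r (pair x (suc m)) (push (frame 4 r x (suc m)) κ)  ⟶*⟨ evaluatesMu em r κ refl ⟩
    returnState y κ                                              ∎
    where open StarReasoning Step

  haltE outputE : Expr
  haltE   = ifzE (differE (fstE input) (lit 1)) (ifzE (sndE (sndE (sndE input))) (lit 0) (lit 1)) (lit 1)
  outputE = fstE (sndE input)

  halt output : ℕ → ℕ
  halt   = evalExpr haltE
  output = evalExpr outputE

  halt≡0 : ∀ a b → ifZero (differ a 1) (ifZero b 0 1) 1 ≡ 0 → a ≡ 1 × b ≡ 0
  halt≡0 a b h with differ a 1 in a≟1
  halt≡0 a zero h | zero = differ≡0⇒≡ a 1 a≟1 , refl

  step-when-halted : ∀ s → halt s ≡ 0 → step s ≡ returnState (output s) 0
  step-when-halted s h with halt≡0 (fst s) (snd (snd (snd s))) h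
  ... | returning , emptyStack = begin
    step s                                   ≡⟨ step-unfold s ⟩
    ifZero (fst s) evaluating returning-on   ≡⟨ cong (λ u → ifZero u evaluating returning-on) returning ⟩
    returning-on                             ≡⟨ returnStepE-meaning (snd s) ⟩
    ifZero (snd (snd (snd s))) (returnState (output s) 0) framing
                                             ≡⟨ cong (λ κ → ifZero κ (returnState (output s) 0) framing) emptyStack ⟩
    returnState (output s) 0                 ∎
    where
    open ≡-Reasoning
    evaluating returning-on framing : ℕ
    evaluating   = evalExpr evalStepE (snd s)
    returning-on = evalExpr returnStepE (snd s)
    framing      = evalExpr frameStepE (pair (pair (fst (snd s)) (snd (pred (snd (snd (snd s))))))
                                             (fst (pred (snd (snd (snd s))))))

  halt-returnState : ∀ y → halt (returnState y 0) ≡ 0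
  halt-returnState y = cong₂ (λ a b → ifZero (differ a 1) (ifZero b 0 1) 1) (fst-pair 1 (pair y (pair 0 0)))
    (trans (cong (λ z → snd (snd z)) (snd-pair 1 (pair y (pair 0 0))))
           (trans (cong snd (snd-pair y (pair 0 0))) (snd-pair 0 0)))

  output-returnState : ∀ y → output (returnState y 0) ≡ y
  output-returnState y = trans (cong fst (snd-pair 1 (pair y (pair 0 0)))) (fst-pair y (pair 0 0))

  steps-when-halted : ∀ s → halt s ≡ 0 → ∀ j → steps (suc j) s ≡ returnState (output s) 0
  steps-when-halted s h zero    = step-when-halted s h
  steps-when-halted s h (suc j) = trans (cong step (steps-when-halted s h j)) (step-halted (output s))

  -- once halted, the machine stays put, so every halting time has the final output
  output-when-halted : ∀ s y d → halt s ≡ 0 → steps d s ≡ returnState y 0 → output s ≡ y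
  output-when-halted s y zero    _ refl = output-returnState y
  output-when-halted s y (suc d) h eq = begin
    output s                                    ≡⟨ sym (output-returnState (output s)) ⟩
    output (returnState (output s) 0)           ≡⟨ cong output (sym (steps-when-halted s h d)) ⟩
    output (steps (suc d) s)                    ≡⟨ cong output eq ⟩
    output (returnState y 0)                    ≡⟨ output-returnState y ⟩
    y                                           ∎
    where open ≡-Reasoning

  initialE : Expr
  initialE = evalStateE (fstE input) (sndE input) (lit 0)

  cSteps : Code
  cSteps = cRec cI (cComp (compile stepE) cSndSnd)

  cSteps-correct : ∀ {f} → Realises f Q G → Realises₂ f cSteps (λ s n → steps n s)
  cSteps-correct hQ = cRec-correct (λ s → s) (λ _ _ y → step y) (λ s n → steps n s) (λ _ → ev-I)
    (λ a n y → cRec-step a n y (ev≡ (compile-correct stepE (stepE-realised hQ) y) (sym (step≡evalExpr y))))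
    (λ _ → refl) (λ _ _ → refl)

  cTrace : Code
  cTrace = cComp cSteps (cPair (cComp (compile initialE) cFst) cSnd)

  cTrace-correct : ∀ {f} → Realises f Q G → Realises₂ f cTrace (λ z m → steps m (evalExpr initialE z))
  cTrace-correct hQ z m = ev-Comp (ev-Pair (ev-Comp (cFst-pair z m) (compile-correct initialE _ z)) (cSnd-pair z m))
                                (cSteps-correct hQ (evalExpr initialE z) m)

  cHalted : Code
  cHalted = cComp (compile haltE) cTrace

  cUniversal : Code
  cUniversal = cComp (cComp (compile outputE) cTrace) (cPair cI (cMu cHalted))

  -- The μ-search for the first halting time starts at m and succeeds at the latest after d more steps.
  search-halting : ∀ {f} → Realises f Q G → ∀ z y n → steps n (evalExpr initialE z) ≡ returnState y 0 →
                   ∀ d m → d + m ≡ n → Σ ℕ λ s → EvMu f cHalted z m s × output (steps s (evalExpr initialE z)) ≡ y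
  search-halting {f} hQ z y n halts d m d+m≡n = searchFrom d m (halt (steps m I)) refl d+m≡n
    where
    I : ℕ
    I = evalExpr initialE z
    checks : ∀ m {v} → halt (steps m I) ≡ v → Ev f cHalted (pair z m) v
    checks m eq = ev-Comp (cTrace-correct hQ z m) (ev≡ (compile-correct haltE _ _) eq)
    searchFrom : ∀ d m v → halt (steps m I) ≡ v → d + m ≡ n →
                 Σ ℕ λ s → EvMu f cHalted z m s × output (steps s I) ≡ y
    searchFrom d m zero eq d+m≡n = m , mu-found (checks m eq) ,
      output-when-halted (steps m I) y d eq (trans (sym (steps-+ d m I)) (trans (cong (λ k → steps k I) d+m≡n) halts))
    searchFrom zero m (suc _) eq refl = ⊥-elim (0≢1+n (trans (sym (halt-returnState y)) (trans (cong halt (sym halts)) eq)))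
    searchFrom (suc d) m (suc _) eq d+m≡n with searchFrom d (suc m) (halt (steps (suc m) I)) refl (trans (+-suc d m) d+m≡n)
    ... | s , em , out = s , mu-next (checks m eq) em , out

  cUniversal-correct : ∀ {f e x y} → Realises f Q G → Ev G (decode e) x y → Ev f cUniversal (pair e x) y
  cUniversal-correct {f} {e} {x} {y} hQ ev with ↝⇒steps (evaluates ev e 0 refl)
  ... | n , halts with search-halting hQ (pair e x) y n (trans (cong₂ (λ a b → steps n (evalState a b 0)) (fst-pair e x) (snd-pair e x)) halts) n 0 (+-identityʳ n)
  ... | s , em , out = ev-Comp (ev-Pair ev-I (ev-Mu em)) (ev-Comp (cTrace-correct hQ (pair e x) s) (ev≡ (compile-correct outputE _ _) out))

-- G enters only through the specification: the code built by Machine Q G does not depend on G.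
cUniversal : Code → Code
cUniversal Q = Machine.cUniversal Q (λ _ → 0)

cUniversal-correct : ∀ {Q G f e x y} → Realises f Q G → Ev G (decode e) x y → Ev f (cUniversal Q) (pair e x) y
cUniversal-correct {Q} {G} = Machine.cUniversal-correct Q G


substOracle : Code → Code → Code
substOracle Q cZ = cZ
substOracle Q cS = cS
substOracle Q cI = cI
substOracle Q cO = Q
substOracle Q cFst = cFst
substOracle Q cSnd = cSnd
substOracle Q (cPair c d) = cPair (substOracle Q c) (substOracle Q d)
substOracle Q (cComp c d) = cComp (substOracle Q c) (substOracle Q d)
substOracle Q (cRec c d) = cRec (substOracle Q c) (substOracle Q d)
substOracle Q (cMu c) = cMu (substOracle Q c)

module _ {fr F : Baire} {Q : Code} (hQ : Realises fr Q F) where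
  substOracle-ev : ∀ {c x y} → Ev F c x y → Ev fr (substOracle Q c) x y
  substOracle-rec : ∀ {c d x n y} → EvRec F c d x n y → EvRec fr (substOracle Q c) (substOracle Q d) x n y
  substOracle-mu : ∀ {c x m y} → EvMu F c x m y → EvMu fr (substOracle Q c) x m y
  substOracle-ev ev-Z = ev-Z
  substOracle-ev ev-S = ev-S
  substOracle-ev ev-I = ev-I
  substOracle-ev {x = x} ev-O = hQ x
  substOracle-ev ev-Fst = ev-Fst
  substOracle-ev ev-Snd = ev-Snd
  substOracle-ev (ev-Pair a b) = ev-Pair (substOracle-ev a) (substOracle-ev b)
  substOracle-ev (ev-Comp a b) = ev-Comp (substOracle-ev a) (substOracle-ev b)
  substOracle-ev (ev-Rec r) = ev-Rec (substOracle-rec r)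
  substOracle-ev (ev-Mu m) = ev-Mu (substOracle-mu m)
  substOracle-rec (rec-zero e) = rec-zero (substOracle-ev e)
  substOracle-rec (rec-suc r e) = rec-suc (substOracle-rec r) (substOracle-ev e)
  substOracle-mu (mu-found e) = mu-found (substOracle-ev e)
  substOracle-mu (mu-next e m) = mu-next (substOracle-ev e) (substOracle-mu m)

substOracle-correct : ∀ {fr F Q c G} → Realises fr Q F → Realises F c G → Realises fr (substOracle Q c) G
substOracle-correct hQ hc x = substOracle-ev hQ (hc x)

joinF-even : ∀ F G q → joinF F G (q * 2) ≡ F q
joinF-even F G zero = refl
joinF-even F G (suc q) = joinF-even (λ k → F (suc k)) (λ k → G (suc k)) q

joinF-odd : ∀ F G q → joinF F G (suc (q * 2)) ≡ G q
joinF-odd F G zero = refl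
joinF-odd F G (suc q) = joinF-odd (λ k → F (suc k)) (λ k → G (suc k)) q

joinF-parity : ∀ F G n → ifZero (n % 2) (F (n / 2)) (G (n / 2)) ≡ joinF F G n
joinF-parity F G n = byParity (n % 2) (n / 2) (m%n<n n 2) (sym (m≡m%n+[m/n]*n n 2))
  where
  byParity : ∀ r q → r < 2 → r + q * 2 ≡ n → ifZero r (F q) (G q) ≡ joinF F G n
  byParity zero          q _ e = trans (sym (joinF-even F G q)) (cong (joinF F G) e)
  byParity (suc zero)    q _ e = trans (sym (joinF-odd F G q)) (cong (joinF F G) e)
  byParity (suc (suc _)) q (s≤s (s≤s ())) _

cJoin : Code → Code → Code
cJoin c c′ = cIfZero (cModBy 1) (cComp c (cDivBy 1)) (cComp c′ (cDivBy 1))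

cJoin-correct : ∀ {fr c c′ F G} → Realises fr c F → Realises fr c′ G → Realises fr (cJoin c c′) (joinF F G)
cJoin-correct {F = F} {G} hc hc′ n =
  ev≡ (cIfZero-correct (cModBy-correct 1) (λ m → ev-Comp (cDivBy-correct 1 m) (hc _))
                       (λ m → ev-Comp (cDivBy-correct 1 m) (hc′ _)) n)
      (joinF-parity F G n)

cDouble : Code
cDouble = cComp (cRec cZ (cComp (cComp cS cS) cSndSnd)) (cPair cZ cI)

cDouble-correct : ∀ {f} → Realises f cDouble (λ i → i * 2)
cDouble-correct n = ev-Comp (ev-Pair ev-Z ev-I)
  (cRec-correct (λ _ → 0) (λ a n y → suc (suc y)) (λ a n → n * 2) (λ _ → ev-Z)
    (λ a n y → cRec-step a n y (ev-Comp ev-S ev-S))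
    (λ _ → refl) (λ _ _ → refl) 0 n)

cDoubleSuc : Code
cDoubleSuc = cComp cS cDouble

cDoubleSuc-correct : ∀ {f} → Realises f cDoubleSuc (λ i → suc (i * 2))
cDoubleSuc-correct n = ev-Comp (cDouble-correct n) ev-S

cEvens cOdds : Code → Code
cEvens c = cComp c cDouble
cOdds  c = cComp c cDoubleSuc

cEvens-correct : ∀ {fr c H F G} → Realises fr c H → (∀ n → H n ≡ joinF F G n) → Realises fr (cEvens c) F
cEvens-correct {F = F} {G} hc e i = ev-Comp (cDouble-correct i) (ev≡ (hc _) (trans (e _) (joinF-even F G i)))

cOdds-correct : ∀ {fr c H F G} → Realises fr c H → (∀ n → H n ≡ joinF F G n) → Realises fr (cOdds c) G
cOdds-correct {F = F} {G} hc e i = ev-Comp (cDoubleSuc-correct i) (ev≡ (hc _) (trans (e _) (joinF-odd F G i)))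

cInput : Code
cInput = cComp cO cS

cInput-correct : ∀ {k f} → Realises (k ⌢ f) cInput f
cInput-correct i = ev-Comp ev-S ev-O

cIndex : Code
cIndex = cComp cO cZ

cIndex-correct : ∀ {k f} → Realises (k ⌢ f) cIndex (λ _ → k)
cIndex-correct i = ev-Comp ev-Z ev-O

cPrepend : Code → Code → Code
cPrepend ck cg = cIfZero cI ck (cComp cg cPred)

cPrepend-correct : ∀ {fr ck cg k g} → Realises fr ck (λ _ → k) → Realises fr cg g → Realises fr (cPrepend ck cg) (k ⌢ g)
cPrepend-correct {k = k} {g} hk hg i =
  ev≡ (cIfZero-correct (λ _ → ev-I) hk (λ m → ev-Comp (cPred-correct m) (hg _)) i) (ifZero≡⌢ i)
  where
  ifZero≡⌢ : ∀ i → ifZero i k (g (pred i)) ≡ (k ⌢ g) i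
  ifZero≡⌢ zero    = refl
  ifZero≡⌢ (suc i) = refl

cReduce : Code → Code → Code → Code
cReduce ck cg c = substOracle (cPrepend ck cg) c

cReduce-correct : ∀ {fr ck cg c k g} {C D : MassProblem} → URed c k C D →
               Realises fr ck (λ _ → k) → Realises fr cg g → D g →
               Σ Baire λ g′ → C g′ × Realises fr (cReduce ck cg c) g′
cReduce-correct red hk hg Dg with red _ Dg
... | g′ , computes , Cg′ = g′ , Cg′ , substOracle-correct (cPrepend-correct hk hg) computes


cInput-ured : ∀ {k} {C : MassProblem} → URed cInput k C C
cInput-ured f cf = f , cInput-correct , cf

cConstOf : Code → Code
cConstOf d = cComp (substOracle cZ d) cIndex

cConstOf-correct : ∀ {k f d v} → Ev zeroOracle d k v → Realises (k ⌢ f) (cConstOf d) (λ _ → v)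
cConstOf-correct e i = ev-Comp (cIndex-correct i) (substOracle-ev (λ _ → ev-Z) e)

cHead cTail : Code
cHead = cComp cFst cPred
cTail = cComp cSnd cPred

cHead-ev : ∀ {f L} x (xs : Vec ℕ L) → Ev f cHead (code (x ∷ xs)) x
cHead-ev x xs = ev-Comp (cPred-correct _) (cFst-pair x (code xs))

cTail-ev : ∀ {f L} x (xs : Vec ℕ L) → Ev f cTail (code (x ∷ xs)) (code xs)
cTail-ev x xs = ev-Comp (cPred-correct _) (cSnd-pair x (code xs))

cEntry : ℕ → Code
cEntry zero = cHead
cEntry (suc j) = cComp (cEntry j) cTail

cEntry-ev : ∀ {f L} (y : Vec ℕ L) (j : Fin L) → Ev f (cEntry (toℕ j)) (code y) (lookup y j)
cEntry-ev (x ∷ xs) zero = cHead-ev x xs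
cEntry-ev (x ∷ xs) (suc j) = ev-Comp (cTail-ev x xs) (cEntry-ev xs j)

cTake : ℕ → Code
cTake zero = cConst 0
cTake (suc m) = cComp cS (cPair cHead (cComp (cTake m) cTail))

cTake-ev : ∀ {f m L} (u : Vec ℕ m) (v : Vec ℕ L) → Ev f (cTake m) (code (u ++ v)) (code u)
cTake-ev [] v = cConst-ev 0 _
cTake-ev (x ∷ u) v = ev-Comp (ev-Pair (cHead-ev x (u ++ v)) (ev-Comp (cTail-ev x (u ++ v)) (cTake-ev u v))) ev-S

cDrop : ℕ → Code
cDrop zero = cI
cDrop (suc m) = cComp (cDrop m) cTail

cDrop-ev : ∀ {f m L} (u : Vec ℕ m) (v : Vec ℕ L) → Ev f (cDrop m) (code (u ++ v)) (code v)
cDrop-ev [] v = ev-I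
cDrop-ev (x ∷ u) v = ev-Comp (cTail-ev x (u ++ v)) (cDrop-ev u v)

cAppend : ℕ → Code
cAppend zero = cSnd
cAppend (suc m) = cComp cS (cPair (cComp cHead cFst) (cComp (cAppend m) (cPair (cComp cTail cFst) cSnd)))

cAppend-ev : ∀ {f m L} (u : Vec ℕ m) (v : Vec ℕ L) → Ev f (cAppend m) (pair (code u) (code v)) (code (u ++ v))
cAppend-ev [] v = cSnd-pair 0 (code v)
cAppend-ev (y ∷ u) v = ev-Comp (ev-Pair (ev-Comp (cFst-pair (code (y ∷ u)) (code v)) (cHead-ev y u))
  (ev-Comp (ev-Pair (ev-Comp (cFst-pair (code (y ∷ u)) (code v)) (cTail-ev y u)) (cSnd-pair (code (y ∷ u)) (code v)))
    (cAppend-ev u v))) ev-S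

code-injective : ∀ {L} (u v : Vec ℕ L) → code u ≡ code v → u ≡ v
code-injective [] [] e = refl
code-injective (x ∷ u) (y ∷ v) e =
  cong₂ _∷_ (pair-injectiveˡ {x} {code u} {y} {code v} (suc-injective e)) (code-injective u v (pair-injectiveʳ {x} {code u} {y} {code v} (suc-injective e)))

module Blocks (A B₋₁ : MassProblem) (B : ℕ → MassProblem) where
  open Interval A B₋₁ B

  RealisesJoinB : Baire → ∀ {L} → Vec ℕ L → Code → Set
  RealisesJoinB fr y c = Σ Baire λ F → joinB y F × Realises fr c F

  RealisesBt : Baire → ∀ {L} → Vec ℕ L → Code → Set
  RealisesBt fr y c = Σ Baire λ F → Bt y F × Realises fr c F

  RealisesEach : Baire → ∀ {L} → Vec ℕ L → Vec Code L → Set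
  RealisesEach fr [] [] = ⊤
  RealisesEach fr (y ∷ ys) (c ∷ cs) = (Σ Baire λ b → B y b × Realises fr c b) × RealisesEach fr ys cs

  cComponents : ∀ L → Code → Vec Code L
  cComponents zero c = []
  cComponents (suc L) c = cEvens c ∷ cComponents L (cOdds c)

  cRest : ℕ → Code → Code
  cRest zero c = c
  cRest (suc L) c = cRest L (cOdds c)

  cNest : ∀ {L} → Vec Code L → Code → Code
  cNest [] c = c
  cNest (c₀ ∷ cs) c = cJoin c₀ (cNest cs c)

  realisesJoinB-++⁻ : ∀ {fr L L′} (u : Vec ℕ L) (v : Vec ℕ L′) c → RealisesJoinB fr (u ++ v) c → RealisesEach fr u (cComponents L c) × RealisesJoinB fr v (cRest L c)
  realisesJoinB-++⁻ [] v c s = tt , s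
  realisesJoinB-++⁻ (y ∷ u) v c (F , (b , r , By , Jr , e) , hc) with realisesJoinB-++⁻ u v (cOdds c) (r , Jr , cOdds-correct hc e)
  ... | bw , s = ((b , By , cEvens-correct hc e) , bw) , s

  realisesJoinB⁻ : ∀ {fr L} (u : Vec ℕ L) c → RealisesJoinB fr u c → RealisesEach fr u (cComponents L c)
  realisesJoinB⁻ [] c s = tt
  realisesJoinB⁻ (y ∷ u) c (F , (b , r , By , Jr , e) , hc) =
    (b , By , cEvens-correct hc e) , realisesJoinB⁻ u (cOdds c) (r , Jr , cOdds-correct hc e)

  realisesJoinB-++⁺ : ∀ {fr L L′} (u : Vec ℕ L) (v : Vec ℕ L′) cs c → RealisesEach fr u cs → RealisesJoinB fr v c → RealisesJoinB fr (u ++ v) (cNest cs c)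
  realisesJoinB-++⁺ [] v [] c bw s = s
  realisesJoinB-++⁺ (y ∷ u) v (c₀ ∷ cs) c ((b , By , hb) , bw) s with realisesJoinB-++⁺ u v cs c bw s
  ... | F , JF , hF = joinF b F , (b , F , By , JF , λ _ → refl) , cJoin-correct hb hF

  realisesJoinB⁺ : ∀ {fr L} (u : Vec ℕ L) cs → RealisesEach fr u cs → RealisesJoinB fr u (cNest cs (cConst 0))
  realisesJoinB⁺ [] [] bw = (λ _ → 0) , tt , cConst-ev 0
  realisesJoinB⁺ (y ∷ u) (c₀ ∷ cs) ((b , By , hb) , bw) with realisesJoinB⁺ u cs bw
  ... | F , JF , hF = joinF b F , (b , F , By , JF , λ _ → refl) , cJoin-correct hb hF

  realisesBt⁻ : ∀ {fr L} (y : Vec ℕ L) c → RealisesBt fr y c → (Σ Baire λ b → B₋₁ b × Realises fr (cEvens c) b) × RealisesJoinB fr y (cOdds c)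
  realisesBt⁻ y c (F , (b , r , Bb , Jr , e) , hc) = (b , Bb , cEvens-correct hc e) , (r , Jr , cOdds-correct hc e)

  realisesBt⁺ : ∀ {fr L} (y : Vec ℕ L) c₀ c → (Σ Baire λ b → B₋₁ b × Realises fr c₀ b) → RealisesJoinB fr y c → RealisesBt fr y (cJoin c₀ c)
  realisesBt⁺ y c₀ c (b , Bb , hb) (F , JF , hF) = joinF b F , (b , F , Bb , JF , λ _ → refl) , cJoin-correct hb hF

  cVariable : ∀ {n} (m : ℕ) → Fin n → Code → Vec Code m
  cVariable m zero c = cComponents m c
  cVariable m (suc i) c = cVariable m i (cRest m c)

  cVariable-correct : ∀ {fr n m} (a : Vec (Vec ℕ m) n) (i : Fin n) c → RealisesJoinB fr (concat a) c → RealisesEach fr (lookup a i) (cVariable m i c)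
  cVariable-correct (v ∷ a) zero c s = proj₁ (realisesJoinB-++⁻ v (concat a) c s)
  cVariable-correct {m = m} (v ∷ a) (suc i) c s = cVariable-correct a i (cRest m c) (proj₂ (realisesJoinB-++⁻ v (concat a) c s))


-- A recursion of length 0 never runs its step, so cGuard c evaluates c on i
-- only for the input pair i 1; cLazyIfZero adds the two guarded branches.
cGuard : Code → Code
cGuard c = cRec cZ (cComp c cFst)

cGuard-skip : ∀ {fr c} i → Ev fr (cGuard c) (pair i 0) 0
cGuard-skip {fr} {c} i = ev-Rec (subst₂ (λ a n → EvRec fr cZ (cComp c cFst) a n 0) (sym (fst-pair i 0)) (sym (snd-pair i 0)) (rec-zero ev-Z))

cGuard-run : ∀ {fr c} i v → Ev fr c i v → Ev fr (cGuard c) (pair i 1) v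
cGuard-run {fr} {c} i v e = ev-Rec (subst₂ (λ a n → EvRec fr cZ (cComp c cFst) a n v) (sym (fst-pair i 1)) (sym (snd-pair i 1))
  (rec-suc (rec-zero ev-Z) (ev-Comp (cFst-pair i (pair 0 0)) e)))

cLazyIfZero : Code → Code → Code → Code
cLazyIfZero b x y = cComp cAdd (cPair (cComp (cGuard x) (cPair cI (cIfZero b (cConst 1) (cConst 0))))
                              (cComp (cGuard y) (cPair cI (cIfZero b (cConst 0) (cConst 1)))))

cLazyIfZero-ev₀ : ∀ {fr b x y B i v} → Realises fr b B → B i ≡ 0 → Ev fr x i v → Ev fr (cLazyIfZero b x y) i v
cLazyIfZero-ev₀ {fr} {b} {x} {y} {B} {i} {v} hb e ex =
  ev-Comp (ev-Pair (ev-Comp (ev-Pair ev-I run-x) (cGuard-run i v ex)) (ev-Comp (ev-Pair ev-I skip-y) (cGuard-skip i)))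
    (ev≡ (cAdd-correct v 0) (+-identityʳ v))
  where
  run-x : Ev fr (cIfZero b (cConst 1) (cConst 0)) i 1
  run-x = ev≡ (cIfZero-correct hb (cConst-ev 1) (cConst-ev 0) i) (cong (λ z → ifZero z 1 0) e)
  skip-y : Ev fr (cIfZero b (cConst 0) (cConst 1)) i 0
  skip-y = ev≡ (cIfZero-correct hb (cConst-ev 0) (cConst-ev 1) i) (cong (λ z → ifZero z 0 1) e)

cLazyIfZero-ev₁ : ∀ {fr b x y B i v k} → Realises fr b B → B i ≡ suc k → Ev fr y i v → Ev fr (cLazyIfZero b x y) i v
cLazyIfZero-ev₁ {fr} {b} {x} {y} {B} {i} {v} hb e ey =
  ev-Comp (ev-Pair (ev-Comp (ev-Pair ev-I skip-x) (cGuard-skip i)) (ev-Comp (ev-Pair ev-I run-y) (cGuard-run i v ey)))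
    (cAdd-correct 0 v)
  where
  skip-x : Ev fr (cIfZero b (cConst 1) (cConst 0)) i 0
  skip-x = ev≡ (cIfZero-correct hb (cConst-ev 1) (cConst-ev 0) i) (cong (λ z → ifZero z 1 0) e)
  run-y : Ev fr (cIfZero b (cConst 0) (cConst 1)) i 1
  run-y = ev≡ (cIfZero-correct hb (cConst-ev 0) (cConst-ev 1) i) (cong (λ z → ifZero z 0 1) e)

cLazyIfZero-correct₀ : ∀ {fr b x y B F} → Realises fr b B → (∀ i → B i ≡ 0) → Realises fr x F → Realises fr (cLazyIfZero b x y) F
cLazyIfZero-correct₀ hb e hx i = cLazyIfZero-ev₀ hb (e i) (hx i)

cLazyIfZero-correct₁ : ∀ {fr b x y B F k} → Realises fr b B → (∀ i → B i ≡ suc k) → Realises fr y F → Realises fr (cLazyIfZero b x y) F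
cLazyIfZero-correct₁ hb e hy i = cLazyIfZero-ev₁ hb (e i) (hy i)


module Terms (A B₋₁ : MassProblem) (B : ℕ → MassProblem) (hyp : IntervalHyp A B₋₁ B)
            (Sig : Signature) (M : Obj) (𝔐 : Interval.Structure A B₋₁ B Sig M) where
  open Interval A B₋₁ B
  open Blocks A B₋₁ B
  open Structure 𝔐
  open IntervalHyp hyp

  m : ℕ
  m = dim M

  cA⇒B : Code
  cA⇒B = proj₁ A≥B
  cB⇒B₋₁ : Code
  cB⇒B₋₁ = proj₁ B≥B₋₁

  cFromA-components : ∀ L → (ℕ → Code) → Code → Vec Code L
  cFromA-components zero ec ca = []
  cFromA-components (suc L) ec ca = cReduce (ec 0) ca cA⇒B ∷ cFromA-components L (λ j → ec (suc j)) ca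

  cFromA-components-correct : ∀ {fr L} (u : Vec ℕ L) ec ca a → (∀ (j : Fin L) → Realises fr (ec (toℕ j)) (λ _ → lookup u j)) →
                              Realises fr ca a → A a → RealisesEach fr u (cFromA-components L ec ca)
  cFromA-components-correct []      ec ca a entries computes-a Aa = tt
  cFromA-components-correct (y ∷ u) ec ca a entries computes-a Aa =
    cReduce-correct (proj₂ A≥B y) (entries zero) computes-a Aa ,
    cFromA-components-correct u (λ j → ec (suc j)) ca a (λ j → entries (suc j)) computes-a Aa

  cFromA-Bt : ℕ → Code → Code → Code
  cFromA-Bt L cy ca = cJoin (cReduce (cConst 0) (cReduce (cConst 0) ca cA⇒B) cB⇒B₋₁)
                            (cNest (cFromA-components L (λ j → cComp (cEntry j) cy) ca) (cConst 0))

  -- B₋₁ is reached through B₀, which is computed from A.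
  cFromA-Bt-correct : ∀ {fr L} (y : Vec ℕ L) cy ca a → Realises fr cy (λ _ → code y) → Realises fr ca a → A a →
                      RealisesBt fr y (cFromA-Bt L cy ca)
  cFromA-Bt-correct y cy ca a computes-y computes-a Aa with cReduce-correct (proj₂ A≥B 0) (cConst-ev 0) computes-a Aa
  ... | g₀ , Bg₀ , computes-g₀ =
    realisesBt⁺ y _ _ (cReduce-correct (proj₂ B≥B₋₁ 0) (cConst-ev 0) computes-g₀ Bg₀)
      (realisesJoinB⁺ y _ (cFromA-components-correct y (λ j → cComp (cEntry j) cy) ca a
                             (λ j i → ev-Comp (computes-y i) (cEntry-ev y j)) computes-a Aa))

  cA⇒Bt : ℕ → Code
  cA⇒Bt L = cFromA-Bt L cIndex cInput

  cA⇒Bt-ured : ∀ {L} (y : Vec ℕ L) → URed (cA⇒Bt L) (code y) (Bt y) A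
  cA⇒Bt-ured y f Af with cFromA-Bt-correct y cIndex cInput f cIndex-correct cInput-correct Af
  ... | g , Bt-g , computes = g , computes , Bt-g

  cVar : ∀ {n} → Fin n → Code
  cVar zero = cTake m
  cVar (suc i) = cComp (cVar i) (cDrop m)

  cVar-ev : ∀ {f n} (a : Vec (Vec ℕ m) n) i → Ev f (cVar i) (code (concat a)) (code (lookup a i))
  cVar-ev (v ∷ a) zero = cTake-ev v (concat a)
  cVar-ev (v ∷ a) (suc i) = ev-Comp (cDrop-ev v (concat a)) (cVar-ev a i)

  cTermValue : ∀ {n} → Term Sig n → Code
  cTermValues : ∀ {n k} → Vec (Term Sig n) k → Code
  cTermValue (var i) = cVar i
  cTermValue (app f ts) = cComp (substOracle cZ (proj₁ (IsMorphism.computable (isMor f)))) (cTermValues ts)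
  cTermValues [] = cConst 0
  cTermValues (t ∷ ts) = cComp (cAppend m) (cPair (cTermValue t) (cTermValues ts))

  module _ {n} (a : Vec (Vec ℕ m) n) (a∈M : All (InObj M) a) where
    evalT-inObj : ∀ t → InObj M (evalT 𝔐 t a)
    evalTs-inObj : ∀ {k} (ts : Vec (Term Sig n) k) → All (InObj M) (evalTs 𝔐 ts a)
    evalT-inObj (var i) = lookup⁺ a∈M i
    evalT-inObj (app f ts) = IsMorphism.preserves (isMor f) _ (concat⁺ (evalTs-inObj ts))
    evalTs-inObj [] = []
    evalTs-inObj (t ∷ ts) = evalT-inObj t ∷ evalTs-inObj ts

    cTermValue-ev : ∀ {f} t → Ev f (cTermValue t) (code (concat a)) (code (evalT 𝔐 t a))
    cTermValues-ev : ∀ {f k} (ts : Vec (Term Sig n) k) → Ev f (cTermValues ts) (code (concat a)) (code (concat (evalTs 𝔐 ts a)))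
    cTermValue-ev (var i) = cVar-ev a i
    cTermValue-ev (app f ts) = ev-Comp (cTermValues-ev ts)
      (substOracle-ev (λ _ → ev-Z) (proj₂ (IsMorphism.computable (isMor f)) _ (concat⁺ (evalTs-inObj ts))))
    cTermValues-ev [] = cConst-ev 0 _
    cTermValues-ev (t ∷ ts) = ev-Comp (ev-Pair (cTermValue-ev t) (cTermValues-ev ts)) (cAppend-ev (evalT 𝔐 t a) (concat (evalTs 𝔐 ts a)))

  cTermBt : ∀ {n} → Term Sig n → Code
  cTermsJoinB : ∀ {n k} → Vec (Term Sig n) k → Code
  cTermBt (var i) = cJoin (cEvens cInput) (cNest (cVariable m i (cOdds cInput)) (cConst 0))
  cTermBt (app f ts) = cReduce (cComp (cTermValues ts) cIndex) (cJoin (cEvens cInput) (cTermsJoinB ts)) (proj₁ (IsMorphism.uniform (isMor f)))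
  cTermsJoinB [] = cConst 0
  cTermsJoinB (t ∷ ts) = cNest (cComponents m (cOdds (cTermBt t))) (cTermsJoinB ts)

  module _ {n} (a : Vec (Vec ℕ m) n) (a∈M : All (InObj M) a) (w : Baire) (Bw : Bt (concat a) w) where
    private
      fr : Baire
      fr = code (concat a) ⌢ w
      B₋₁-part : Σ Baire λ b → B₋₁ b × Realises fr (cEvens cInput) b
      B₋₁-part = proj₁ (realisesBt⁻ (concat a) cInput (w , Bw , cInput-correct))
      B-parts : RealisesJoinB fr (concat a) (cOdds cInput)
      B-parts = proj₂ (realisesBt⁻ (concat a) cInput (w , Bw , cInput-correct))

    cTermBt-correct : ∀ t → RealisesBt fr (evalT 𝔐 t a) (cTermBt t)
    cTermsJoinB-correct : ∀ {k} (ts : Vec (Term Sig n) k) → RealisesJoinB fr (concat (evalTs 𝔐 ts a)) (cTermsJoinB ts)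
    cTermBt-correct (var i) =
      realisesBt⁺ (lookup a i) _ _ B₋₁-part (realisesJoinB⁺ (lookup a i) _ (cVariable-correct a i (cOdds cInput) B-parts))
    cTermBt-correct (app f ts)
      with realisesBt⁺ (concat (evalTs 𝔐 ts a)) (cEvens cInput) (cTermsJoinB ts) B₋₁-part (cTermsJoinB-correct ts)
    ... | G , BtG , computes-G with cReduce-correct (proj₂ (IsMorphism.uniform (isMor f)) _ (concat⁺ (evalTs-inObj a a∈M ts)))
                                      (λ i → ev-Comp (cIndex-correct i) (cTermValues-ev a a∈M ts)) computes-G BtG
    ... | g , Bt-g , computes = g , Bt-g , computes
    cTermsJoinB-correct [] = (λ _ → 0) , tt , cConst-ev 0
    cTermsJoinB-correct (t ∷ ts) = realisesJoinB-++⁺ (evalT 𝔐 t a) (concat (evalTs 𝔐 ts a)) _ _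
      (realisesJoinB⁻ (evalT 𝔐 t a) _ (proj₂ (realisesBt⁻ (evalT 𝔐 t a) (cTermBt t) (cTermBt-correct t)))) (cTermsJoinB-correct ts)


cApplyIndex : Code → Code → Code
cApplyIndex cg ch = cComp (cUniversal cg) (cPair (cComp ch (cConst 0)) cI)

cApplyIndex-correct : ∀ {fr cg ch G h k} → Realises fr ch h → Realises fr cg G → Computes (decode (h 0)) G k →
                      Realises fr (cApplyIndex cg ch) k
cApplyIndex-correct {cg = cg} hh hg computes i =
  ev-Comp (ev-Pair (ev-Comp (cConst-ev 0 i) (hh 0)) ev-I) (cUniversal-correct {Q = cg} hg (computes i))

module Dichotomies (A B₋₁ : MassProblem) (B : ℕ → MassProblem) (hyp : IntervalHyp A B₋₁ B)
                   (Sig : Signature) (M : Obj) (𝔐 : Interval.Structure A B₋₁ B Sig M) (n : ℕ) where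
  open Interval A B₋₁ B
  open Blocks A B₋₁ B
  open Terms A B₋₁ B hyp Sig M 𝔐

  Parameters : Set
  Parameters = Vec (Vec ℕ m) n

  Den : Δ₀₀Formula Sig n → Parameters → MassProblem
  Den φ a = ⟦_⟧ 𝔐 φ a

  Sat : Δ₀₀Formula Sig n → Parameters → Set
  Sat φ a = Holds 𝔐 φ a

  DichotomyAt : Δ₀₀Formula Sig n → Parameters → Code → Code → Code → Code → Code → Set
  DichotomyAt φ a d Φ₁ Ψ₁ Φ₂ Ψ₂ =
      (Sat φ a × Ev zeroOracle d (code (concat a)) 0
        × URed Φ₁ (code (concat a)) (Den φ a) (Bt (concat a))
        × URed Ψ₁ (code (concat a)) (Bt (concat a)) (Den φ a))
      ⊎
      (¬ Sat φ a × Ev zeroOracle d (code (concat a)) 1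
        × URed Φ₂ (code (concat a)) (Den φ a) A
        × URed Ψ₂ (code (concat a)) A (Den φ a))

  record Dichotomy (φ : Δ₀₀Formula Sig n) : Set where
    constructor mkDichotomy
    field
      d Φ₁ Ψ₁ Φ₂ Ψ₂ : Code
      cases : ∀ a → All (InObj M) a → DichotomyAt φ a d Φ₁ Ψ₁ Φ₂ Ψ₂

  Outcome : ∀ {φ} → Dichotomy φ → Parameters → Set
  Outcome {φ} R a = let open Dichotomy R in DichotomyAt φ a d Φ₁ Ψ₁ Φ₂ Ψ₂

  -- Whatever the outcome, A reduces to ⟦φ⟧ and ⟦φ⟧ to Bt, uniformly: the
  -- decision code chooses, without running the other one, which reduction to use.
  module _ {φ} (R : Dichotomy φ) where
    open Dichotomy R

    cDecision cFromA cFromBt : Code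
    cDecision = cConstOf d
    cFromA    = cLazyIfZero cDecision (cReduce cIndex (cA⇒Bt (n * m)) Φ₁) Φ₂
    cFromBt   = cLazyIfZero cDecision Ψ₁ (cReduce cIndex Ψ₂ (cA⇒Bt (n * m)))

    cFromA-ured : ∀ a → All (InObj M) a → URed cFromA (code (concat a)) (Den φ a) A
    cFromA-ured a a∈M f Af with cases a a∈M
    ... | inj₁ (_ , dec , Φ₁-ured , _) with cA⇒Bt-ured (concat a) f Af
    ...   | bt , computes-bt , Bt-bt with cReduce-correct Φ₁-ured cIndex-correct computes-bt Bt-bt
    ...     | g , Dg , computes = g , cLazyIfZero-correct₀ (cConstOf-correct dec) (λ _ → refl) computes , Dg
    cFromA-ured a a∈M f Af | inj₂ (_ , dec , Φ₂-ured , _) with Φ₂-ured f Af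
    ... | g , computes , Dg = g , cLazyIfZero-correct₁ (cConstOf-correct dec) (λ _ → refl) computes , Dg

    cFromBt-ured : ∀ a → All (InObj M) a → URed cFromBt (code (concat a)) (Bt (concat a)) (Den φ a)
    cFromBt-ured a a∈M f Df with cases a a∈M
    ... | inj₁ (_ , dec , _ , Ψ₁-ured) with Ψ₁-ured f Df
    ...   | g , computes , Bg = g , cLazyIfZero-correct₀ (cConstOf-correct dec) (λ _ → refl) computes , Bg
    cFromBt-ured a a∈M f Df | inj₂ (_ , dec , _ , Ψ₂-ured) with Ψ₂-ured f Df
    ... | g , computes , Ag with cReduce-correct (cA⇒Bt-ured (concat a)) cIndex-correct computes Ag
    ...   | bt , Bt-bt , computes-bt = bt , cLazyIfZero-correct₁ (cConstOf-correct dec) (λ _ → refl) computes-bt , Bt-bt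

  dichotomy-⊤ : Dichotomy ⊤ᶠ
  dichotomy-⊤ = mkDichotomy (cConst 0) cInput cInput cZ cZ
    (λ _ _ → inj₁ (tt , cConst-ev 0 _ , cInput-ured , cInput-ured))

  dichotomy-⊥ : Dichotomy ⊥ᶠ
  dichotomy-⊥ = mkDichotomy (cConst 1) cZ cZ cInput cInput
    (λ _ _ → inj₂ ((λ ()) , cConst-ev 1 _ , cInput-ured , cInput-ured))

  module Equation (t₁ t₂ : Term Sig n) where
    d Φ₁ Ψ₁ Φ₂ Ψ₂ : Code
    d  = cComp cDiffer (cPair (cTermValue t₁) (cTermValue t₂))
    Φ₁ = cJoin (cJoin (cEvens cInput) (cTermsJoinB (t₁ ∷ t₂ ∷ []))) cInput
    Ψ₁ = cOdds cInput
    Φ₂ = cJoin cInput (cA⇒Bt (n * m))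
    Ψ₂ = cEvens cInput

    module _ (a : Parameters) (a∈M : All (InObj M) a) where
      k : ℕ
      k = code (concat a)

      x₁ x₂ : Vec ℕ m
      x₁ = evalT 𝔐 t₁ a
      x₂ = evalT 𝔐 t₂ a

      decides : Ev zeroOracle d k (differ (code x₁) (code x₂))
      decides = ev-Comp (ev-Pair (cTermValue-ev a a∈M t₁) (cTermValue-ev a a∈M t₂)) (cDiffer-correct (code x₁) (code x₂))

      Φ₁-ured : x₁ ≡ x₂ → URed Φ₁ k (Den (t₁ ≐ t₂) a) (Bt (concat a))
      Φ₁-ured x₁≡x₂ b Bb with realisesBt⁺ (concat (x₁ ∷ x₂ ∷ [])) (cEvens cInput) (cTermsJoinB (t₁ ∷ t₂ ∷ []))
                                (proj₁ (realisesBt⁻ (concat a) cInput (b , Bb , cInput-correct)))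
                                (cTermsJoinB-correct a a∈M b Bb (t₁ ∷ t₂ ∷ []))
      ... | G , BtG , computes = joinF G b , cJoin-correct computes cInput-correct , (G , b , inj₁ (x₁≡x₂ , BtG) , Bb , λ _ → refl)

      Ψ₁-ured : URed Ψ₁ k (Bt (concat a)) (Den (t₁ ≐ t₂) a)
      Ψ₁-ured w (_ , g₂ , _ , Bg₂ , e) = g₂ , cOdds-correct cInput-correct e , Bg₂

      Φ₂-ured : x₁ ≢ x₂ → URed Φ₂ k (Den (t₁ ≐ t₂) a) A
      Φ₂-ured x₁≢x₂ a₀ Aa₀ with cA⇒Bt-ured (concat a) a₀ Aa₀
      ... | bt , computes , Bt-bt = joinF a₀ bt , cJoin-correct cInput-correct computes ,
                                    (a₀ , bt , inj₂ (x₁≢x₂ , Aa₀) , Bt-bt , λ _ → refl)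

      Ψ₂-ured : x₁ ≢ x₂ → URed Ψ₂ k A (Den (t₁ ≐ t₂) a)
      Ψ₂-ured x₁≢x₂ w (_ , _ , inj₁ (x₁≡x₂ , _) , _ , _) = ⊥-elim (x₁≢x₂ x₁≡x₂)
      Ψ₂-ured x₁≢x₂ w (g₁ , _ , inj₂ (_ , Ag₁) , _ , e) = g₁ , cEvens-correct cInput-correct e , Ag₁

      compared-cases : ∀ v → differ (code x₁) (code x₂) ≡ v → DichotomyAt (t₁ ≐ t₂) a d Φ₁ Ψ₁ Φ₂ Ψ₂
      compared-cases zero compared = inj₁ (x₁≡x₂ , ev≡ decides compared , Φ₁-ured x₁≡x₂ , Ψ₁-ured)
        where
        x₁≡x₂ : x₁ ≡ x₂
        x₁≡x₂ = code-injective x₁ x₂ (differ≡0⇒≡ (code x₁) (code x₂) compared)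
      compared-cases (suc _) compared =
        inj₂ (x₁≢x₂ , ev≡ decides (≢⇒differ≡1 (code x₁) (code x₂) (λ c≡ → x₁≢x₂ (code-injective x₁ x₂ c≡))) ,
              Φ₂-ured x₁≢x₂ , Ψ₂-ured x₁≢x₂)
        where
        x₁≢x₂ : x₁ ≢ x₂
        x₁≢x₂ x₁≡x₂ = 0≢1+n (trans (sym (differ-refl (code x₁))) (trans (cong (λ z → differ (code x₁) (code z)) x₁≡x₂) compared))

      cases : DichotomyAt (t₁ ≐ t₂) a d Φ₁ Ψ₁ Φ₂ Ψ₂
      cases = compared-cases _ refl

  dichotomy-≐ : ∀ t₁ t₂ → Dichotomy (t₁ ≐ t₂)
  dichotomy-≐ t₁ t₂ = mkDichotomy d Φ₁ Ψ₁ Φ₂ Ψ₂ cases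
    where open Equation t₁ t₂

  module Conjunction {φ ψ} (R : Dichotomy φ) (S : Dichotomy ψ) where
    private
      module R = Dichotomy R
      module S = Dichotomy S

    d Φ₁ Ψ₁ Φ₂ Ψ₂ : Code
    d  = cComp cSg (cComp cAdd (cPair R.d S.d))
    Φ₁ = cJoin R.Φ₁ S.Φ₁
    Ψ₁ = cReduce cIndex (cEvens cInput) R.Ψ₁
    Φ₂ = cJoin (cFromA R) (cFromA S)
    Ψ₂ = cLazyIfZero (cDecision R) (cReduce cIndex (cOdds cInput) S.Ψ₂) (cReduce cIndex (cEvens cInput) R.Ψ₂)

    module _ (a : Parameters) (a∈M : All (InObj M) a) where
      k : ℕ
      k = code (concat a)

      decides : ∀ {x y} → Ev zeroOracle R.d k x → Ev zeroOracle S.d k y → Ev zeroOracle d k (sg (x + y))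
      decides {x} {y} ex ey = ev-Comp (ev-Comp (ev-Pair ex ey) (cAdd-correct x y)) (cSg-correct (x + y))

      Φ₁-ured : URed R.Φ₁ k (Den φ a) (Bt (concat a)) → URed S.Φ₁ k (Den ψ a) (Bt (concat a)) →
                URed Φ₁ k (Den (φ ∧ᶠ ψ) a) (Bt (concat a))
      Φ₁-ured r₁ r₂ f Bf with r₁ f Bf | r₂ f Bf
      ... | g₁ , c₁ , D₁ | g₂ , c₂ , D₂ = joinF g₁ g₂ , cJoin-correct c₁ c₂ , (g₁ , g₂ , D₁ , D₂ , λ _ → refl)

      Ψ₁-ured : URed R.Ψ₁ k (Bt (concat a)) (Den φ a) → URed Ψ₁ k (Bt (concat a)) (Den (φ ∧ᶠ ψ) a)
      Ψ₁-ured s₁ w (g₁ , _ , D₁ , _ , e) with cReduce-correct s₁ cIndex-correct (cEvens-correct cInput-correct e) D₁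
      ... | g , Bg , computes = g , computes , Bg

      Φ₂-ured : URed Φ₂ k (Den (φ ∧ᶠ ψ) a) A
      Φ₂-ured f Af with cFromA-ured R a a∈M f Af | cFromA-ured S a a∈M f Af
      ... | g₁ , c₁ , D₁ | g₂ , c₂ , D₂ = joinF g₁ g₂ , cJoin-correct c₁ c₂ , (g₁ , g₂ , D₁ , D₂ , λ _ → refl)

      Ψ₂-ured-right : Ev zeroOracle R.d k 0 → URed S.Ψ₂ k A (Den ψ a) → URed Ψ₂ k A (Den (φ ∧ᶠ ψ) a)
      Ψ₂-ured-right decR s₂ w (_ , g₂ , _ , D₂ , e) with cReduce-correct s₂ cIndex-correct (cOdds-correct cInput-correct e) D₂
      ... | g , Ag , computes = g , cLazyIfZero-correct₀ (cConstOf-correct decR) (λ _ → refl) computes , Ag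

      Ψ₂-ured-left : Ev zeroOracle R.d k 1 → URed R.Ψ₂ k A (Den φ a) → URed Ψ₂ k A (Den (φ ∧ᶠ ψ) a)
      Ψ₂-ured-left decR s₁ w (g₁ , _ , D₁ , _ , e) with cReduce-correct s₁ cIndex-correct (cEvens-correct cInput-correct e) D₁
      ... | g , Ag , computes = g , cLazyIfZero-correct₁ (cConstOf-correct decR) (λ _ → refl) computes , Ag

      cases : Outcome R a → Outcome S a → DichotomyAt (φ ∧ᶠ ψ) a d Φ₁ Ψ₁ Φ₂ Ψ₂
      cases (inj₁ (φ✓ , e₁ , r₁ , s₁)) (inj₁ (ψ✓ , e₂ , r₂ , _)) =
        inj₁ ((φ✓ , ψ✓) , decides e₁ e₂ , Φ₁-ured r₁ r₂ , Ψ₁-ured s₁)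
      cases (inj₁ (_ , e₁ , _ , _)) (inj₂ (ψ✗ , e₂ , _ , s₂)) =
        inj₂ (ψ✗ ∘ proj₂ , decides e₁ e₂ , Φ₂-ured , Ψ₂-ured-right e₁ s₂)
      cases (inj₂ (φ✗ , e₁ , _ , s₁)) outcomeS =
        inj₂ (φ✗ ∘ proj₁ , decides′ outcomeS , Φ₂-ured , Ψ₂-ured-left e₁ s₁)
        where
        decides′ : Outcome S a → Ev zeroOracle d k 1
        decides′ (inj₁ (_ , e₂ , _)) = decides e₁ e₂
        decides′ (inj₂ (_ , e₂ , _)) = decides e₁ e₂

  dichotomy-∧ : ∀ {φ ψ} → Dichotomy φ → Dichotomy ψ → Dichotomy (φ ∧ᶠ ψ)
  dichotomy-∧ R S = mkDichotomy d Φ₁ Ψ₁ Φ₂ Ψ₂ (λ a a∈M → cases a a∈M (R.cases a a∈M) (S.cases a a∈M))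
    where
    open Conjunction R S
    module R = Dichotomy R
    module S = Dichotomy S

  cOracleHead : Code
  cOracleHead = cComp cO (cConst 1)

  cOracleHead-correct : ∀ {k h} → Realises (k ⌢ h) cOracleHead (λ _ → h 0)
  cOracleHead-correct i = ev-Comp (cConst-ev 1 i) ev-O

  cOracleTail : Code
  cOracleTail = cComp cO (cComp cS cS)

  cOracleTail-correct : ∀ {k h} → Realises (k ⌢ h) cOracleTail (tail h)
  cOracleTail-correct i = ev-Comp (ev-Comp ev-S ev-S) ev-O

  module Disjunction {φ ψ} (R : Dichotomy φ) (S : Dichotomy ψ) where
    private
      module R = Dichotomy R
      module S = Dichotomy S

    d Φ₁ Ψ₁ Φ₂ Ψ₂ : Code
    d  = cIfZero R.d (cConst 0) S.d
    Φ₁ = cLazyIfZero (cDecision R) (cPrepend (cConst 0) R.Φ₁) (cPrepend (cConst 1) S.Φ₁)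
    Ψ₁ = cLazyIfZero cOracleHead (cReduce cIndex cOracleTail (cFromBt R)) (cReduce cIndex cOracleTail (cFromBt S))
    Φ₂ = cPrepend (cConst 0) R.Φ₂
    Ψ₂ = cLazyIfZero cOracleHead (cReduce cIndex cOracleTail R.Ψ₂) (cReduce cIndex cOracleTail S.Ψ₂)

    module _ (a : Parameters) (a∈M : All (InObj M) a) where
      k : ℕ
      k = code (concat a)

      Φ₁-ured-left : Ev zeroOracle R.d k 0 → URed R.Φ₁ k (Den φ a) (Bt (concat a)) → URed Φ₁ k (Den (φ ∨ᶠ ψ) a) (Bt (concat a))
      Φ₁-ured-left decR r₁ f Bf with r₁ f Bf
      ... | g , computes , Dg = 0 ⌢ g , cLazyIfZero-correct₀ (cConstOf-correct decR) (λ _ → refl) (cPrepend-correct (cConst-ev 0) computes) ,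
                                inj₁ (refl , Dg)

      Φ₁-ured-right : Ev zeroOracle R.d k 1 → URed S.Φ₁ k (Den ψ a) (Bt (concat a)) → URed Φ₁ k (Den (φ ∨ᶠ ψ) a) (Bt (concat a))
      Φ₁-ured-right decR r₂ f Bf with r₂ f Bf
      ... | g , computes , Dg = 1 ⌢ g , cLazyIfZero-correct₁ (cConstOf-correct decR) (λ _ → refl) (cPrepend-correct (cConst-ev 1) computes) ,
                                inj₂ (refl , Dg)

      Ψ₁-ured : URed Ψ₁ k (Bt (concat a)) (Den (φ ∨ᶠ ψ) a)
      Ψ₁-ured h (inj₁ (h0≡0 , D)) with cReduce-correct (cFromBt-ured R a a∈M) cIndex-correct cOracleTail-correct D
      ... | g , Bg , computes = g , cLazyIfZero-correct₀ cOracleHead-correct (λ _ → h0≡0) computes , Bg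
      Ψ₁-ured h (inj₂ (h0≡1 , D)) with cReduce-correct (cFromBt-ured S a a∈M) cIndex-correct cOracleTail-correct D
      ... | g , Bg , computes = g , cLazyIfZero-correct₁ cOracleHead-correct (λ _ → h0≡1) computes , Bg

      Φ₂-ured : URed R.Φ₂ k (Den φ a) A → URed Φ₂ k (Den (φ ∨ᶠ ψ) a) A
      Φ₂-ured r₁ f Af with r₁ f Af
      ... | g , computes , Dg = 0 ⌢ g , cPrepend-correct (cConst-ev 0) computes , inj₁ (refl , Dg)

      Ψ₂-ured : URed R.Ψ₂ k A (Den φ a) → URed S.Ψ₂ k A (Den ψ a) → URed Ψ₂ k A (Den (φ ∨ᶠ ψ) a)
      Ψ₂-ured s₁ s₂ h (inj₁ (h0≡0 , D)) with cReduce-correct s₁ cIndex-correct cOracleTail-correct D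
      ... | g , Ag , computes = g , cLazyIfZero-correct₀ cOracleHead-correct (λ _ → h0≡0) computes , Ag
      Ψ₂-ured s₁ s₂ h (inj₂ (h0≡1 , D)) with cReduce-correct s₂ cIndex-correct cOracleTail-correct D
      ... | g , Ag , computes = g , cLazyIfZero-correct₁ cOracleHead-correct (λ _ → h0≡1) computes , Ag

      cases : Outcome R a → Outcome S a → DichotomyAt (φ ∨ᶠ ψ) a d Φ₁ Ψ₁ Φ₂ Ψ₂
      cases (inj₁ (φ✓ , e₁ , r₁ , _)) outcomeS = inj₁ (inj₁ φ✓ , decides outcomeS , Φ₁-ured-left e₁ r₁ , Ψ₁-ured)
        where
        decides : Outcome S a → Ev zeroOracle d k 0
        decides (inj₁ (_ , e₂ , _)) = cIfZero-ev e₁ (cConst-ev 0 _) e₂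
        decides (inj₂ (_ , e₂ , _)) = cIfZero-ev e₁ (cConst-ev 0 _) e₂
      cases (inj₂ (_ , e₁ , _ , _)) (inj₁ (ψ✓ , e₂ , r₂ , _)) =
        inj₁ (inj₂ ψ✓ , cIfZero-ev e₁ (cConst-ev 0 _) e₂ , Φ₁-ured-right e₁ r₂ , Ψ₁-ured)
      cases (inj₂ (φ✗ , e₁ , r₁ , s₁)) (inj₂ (ψ✗ , e₂ , _ , s₂)) =
        inj₂ (Data.Sum.[ φ✗ , ψ✗ ] , cIfZero-ev e₁ (cConst-ev 0 _) e₂ , Φ₂-ured r₁ , Ψ₂-ured s₁ s₂)

  dichotomy-∨ : ∀ {φ ψ} → Dichotomy φ → Dichotomy ψ → Dichotomy (φ ∨ᶠ ψ)
  dichotomy-∨ R S = mkDichotomy d Φ₁ Ψ₁ Φ₂ Ψ₂ (λ a a∈M → cases a a∈M (R.cases a a∈M) (S.cases a a∈M))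
    where
    open Disjunction R S
    module R = Dichotomy R
    module S = Dichotomy S

  Imp : Δ₀₀Formula Sig n → Δ₀₀Formula Sig n → Parameters → MassProblem
  Imp φ ψ a = Den φ a →ᴹ Den ψ a

  cOdds-oracle : ∀ {g X} → Realises (joinF g X) (cOdds cO) X
  cOdds-oracle = cOdds-correct (λ _ → ev-O) (λ _ → refl)

  cEvens-oracle : ∀ {g X} → Realises (joinF g X) (cEvens cO) g
  cEvens-oracle = cEvens-correct (λ _ → ev-O) (λ _ → refl)

  cJoinIndex : Code
  cJoinIndex = cComp (cOdds cO) (cConst 0)

  cJoinIndex-correct : ∀ {g k b} → Realises (joinF g (k ⌢ b)) cJoinIndex (λ _ → k)
  cJoinIndex-correct i = ev-Comp (cConst-ev 0 i) (cOdds-oracle 0)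

  encode⌢-implication : ∀ φ ψ a {f} c → (∀ g → Den φ a g → Σ Baire λ h → Realises (joinF g f) c h × Den ψ a h) →
                        Imp φ ψ a (encode c ⌢ f)
  encode⌢-implication φ ψ a c impl g Dg with impl g Dg
  ... | h , computes , Dh = h , subst (λ c′ → Computes c′ _ h) (sym (decode-encode c)) computes , Dh

  -- An element e ⌢ (k ⌢ f) of the implication runs Φ_e on g ⊕ (k ⌢ f) for g ∈ ⟦φ⟧.
  -- Its program is fixed in advance: cWhenψ uses f ∈ Bt when ψ holds, cWhen¬φ
  -- refutes g when φ fails, and cWhen¬ψ uses f ∈ A when ψ fails.
  module Implication {φ ψ} (R : Dichotomy φ) (S : Dichotomy ψ) where
    private
      module R = Dichotomy R
      module S = Dichotomy S

    cWhenψ cWhen¬φ cWhen¬ψ : Code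
    cWhenψ  = substOracle (cOdds cO) S.Φ₁
    cWhen¬φ = substOracle (cPrepend cJoinIndex (substOracle (cPrepend cJoinIndex (cEvens cO)) R.Ψ₂)) (cFromA S)
    cWhen¬ψ = substOracle (cOdds cO) S.Φ₂

    -- cModusPonens applies the program h 0 of an element h ⊕ b of the implication
    -- to the element of ⟦φ⟧ obtained from b.
    cModusPonens : Code
    cModusPonens = cApplyIndex (cJoin (cReduce cIndex (cOdds cInput) R.Φ₁) (cComp (cEvens cInput) cS)) (cEvens cInput)

    d Φ₁ Ψ₁ Φ₂ Ψ₂ : Code
    d  = cIfZero R.d S.d (cConst 0)
    Φ₁ = cJoin (cPrepend (cIfZero (cDecision R) (cConst (encode cWhenψ)) (cConst (encode cWhen¬φ))) cO) cInput
    Ψ₁ = cOdds cInput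
    Φ₂ = cJoin (cPrepend (cConst (encode cWhen¬ψ)) cO) (cA⇒Bt (n * m))
    Ψ₂ = cReduce cIndex cModusPonens S.Ψ₂

    module _ (a : Parameters) (a∈M : All (InObj M) a) where
      k : ℕ
      k = code (concat a)

      whenψ : URed S.Φ₁ k (Den ψ a) (Bt (concat a)) → ∀ b → Bt (concat a) b → Imp φ ψ a (encode cWhenψ ⌢ (k ⌢ b))
      whenψ r₂ b Bb = encode⌢-implication φ ψ a cWhenψ λ g _ → case r₂ b Bb of λ where
        (h , computes , Dh) → h , substOracle-correct cOdds-oracle computes , Dh

      when¬φ : URed R.Ψ₂ k A (Den φ a) → ∀ b → Imp φ ψ a (encode cWhen¬φ ⌢ (k ⌢ b))
      when¬φ s₁ b = encode⌢-implication φ ψ a cWhen¬φ λ g Dg → case s₁ g Dg of λ where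
        (a₁ , refutes , Aa₁) → case cFromA-ured S a a∈M a₁ Aa₁ of λ where
          (h , computes , Dh) → h , substOracle-correct (cPrepend-correct cJoinIndex-correct
                                      (substOracle-correct (cPrepend-correct cJoinIndex-correct cEvens-oracle) refutes)) computes , Dh

      when¬ψ : URed S.Φ₂ k (Den ψ a) A → ∀ a₀ → A a₀ → Imp φ ψ a (encode cWhen¬ψ ⌢ (k ⌢ a₀))
      when¬ψ r₂ a₀ Aa₀ = encode⌢-implication φ ψ a cWhen¬ψ λ g _ → case r₂ a₀ Aa₀ of λ where
        (h , computes , Dh) → h , substOracle-correct cOdds-oracle computes , Dh

      Φ₁-ured : ∀ v → Ev zeroOracle R.d k v →
                (∀ b → Bt (concat a) b → Imp φ ψ a (ifZero v (encode cWhenψ) (encode cWhen¬φ) ⌢ (k ⌢ b))) →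
                URed Φ₁ k (Den (φ ⇒ᶠ ψ) a) (Bt (concat a))
      Φ₁-ured v decR implication b Bb =
        joinF h b , cJoin-correct computes cInput-correct , (h , b , implication b Bb , Bb , λ _ → refl)
        where
        h : Baire
        h = ifZero v (encode cWhenψ) (encode cWhen¬φ) ⌢ (k ⌢ b)
        computes : Realises (k ⌢ b) (cPrepend (cIfZero (cDecision R) (cConst (encode cWhenψ)) (cConst (encode cWhen¬φ))) cO) h
        computes = cPrepend-correct (cIfZero-correct (cConstOf-correct decR) (cConst-ev _) (cConst-ev _)) (λ _ → ev-O)

      Ψ₁-ured : URed Ψ₁ k (Bt (concat a)) (Den (φ ⇒ᶠ ψ) a)
      Ψ₁-ured w (_ , b , _ , Bb , e) = b , cOdds-correct cInput-correct e , Bb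

      Φ₂-ured : URed S.Φ₂ k (Den ψ a) A → URed Φ₂ k (Den (φ ⇒ᶠ ψ) a) A
      Φ₂-ured r₂ a₀ Aa₀ with cA⇒Bt-ured (concat a) a₀ Aa₀
      ... | bt , computes , Bt-bt = joinF (encode cWhen¬ψ ⌢ (k ⌢ a₀)) bt ,
                                    cJoin-correct (cPrepend-correct (cConst-ev _) (λ _ → ev-O)) computes ,
                                    (_ , bt , when¬ψ r₂ a₀ Aa₀ , Bt-bt , λ _ → refl)

      Ψ₂-ured : URed R.Φ₁ k (Den φ a) (Bt (concat a)) → URed S.Ψ₂ k A (Den ψ a) → URed Ψ₂ k A (Den (φ ⇒ᶠ ψ) a)
      Ψ₂-ured r₁ s₂ w (h , b , implication , Bb , e) =
        case cReduce-correct r₁ cIndex-correct (cOdds-correct cInput-correct e) Bb of λ where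
          (g , Dg , computes-g) → case implication g Dg of λ where
            (h′ , applies , Dh′) → case cReduce-correct s₂ cIndex-correct (applied computes-g applies) Dh′ of λ where
              (a′ , Aa′ , computes) → a′ , computes , Aa′
        where
        computes-h : Realises (k ⌢ w) (cEvens cInput) h
        computes-h = cEvens-correct cInput-correct e
        applied : ∀ {g h′} → Realises (k ⌢ w) (cReduce cIndex (cOdds cInput) R.Φ₁) g →
                  Computes (decode (h 0)) (joinF g (tail h)) h′ → Realises (k ⌢ w) cModusPonens h′
        applied computes-g = cApplyIndex-correct computes-h (cJoin-correct computes-g (λ i → ev-Comp ev-S (computes-h (suc i))))

      cases : Outcome R a → Outcome S a → DichotomyAt (φ ⇒ᶠ ψ) a d Φ₁ Ψ₁ Φ₂ Ψ₂
      cases (inj₁ (φ✓ , e₁ , r₁ , _)) (inj₁ (ψ✓ , e₂ , r₂ , _)) =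
        inj₁ ((λ _ → ψ✓) , cIfZero-ev e₁ e₂ (cConst-ev 0 _) , Φ₁-ured 0 e₁ (whenψ r₂) , Ψ₁-ured)
      cases (inj₁ (φ✓ , e₁ , r₁ , _)) (inj₂ (ψ✗ , e₂ , r₂ , s₂)) =
        inj₂ ((λ φ→ψ → ψ✗ (φ→ψ φ✓)) , cIfZero-ev e₁ e₂ (cConst-ev 0 _) , Φ₂-ured r₂ , Ψ₂-ured r₁ s₂)
      cases (inj₂ (φ✗ , e₁ , _ , s₁)) outcomeS =
        inj₁ ((λ φ✓ → ⊥-elim (φ✗ φ✓)) , decides outcomeS , Φ₁-ured 1 e₁ (λ b _ → when¬φ s₁ b) , Ψ₁-ured)
        where
        decides : Outcome S a → Ev zeroOracle d k 0
        decides (inj₁ (_ , e₂ , _)) = cIfZero-ev e₁ e₂ (cConst-ev 0 _)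
        decides (inj₂ (_ , e₂ , _)) = cIfZero-ev e₁ e₂ (cConst-ev 0 _)

  dichotomy-⇒ : ∀ {φ ψ} → Dichotomy φ → Dichotomy ψ → Dichotomy (φ ⇒ᶠ ψ)
  dichotomy-⇒ R S = mkDichotomy d Φ₁ Ψ₁ Φ₂ Ψ₂ (λ a a∈M → cases a a∈M (R.cases a a∈M) (S.cases a a∈M))
    where
    open Implication R S
    module R = Dichotomy R
    module S = Dichotomy S

  dichotomy : ∀ φ → Dichotomy φ
  dichotomy (t₁ ≐ t₂) = dichotomy-≐ t₁ t₂
  dichotomy ⊤ᶠ        = dichotomy-⊤
  dichotomy ⊥ᶠ        = dichotomy-⊥
  dichotomy (φ ∧ᶠ ψ)  = dichotomy-∧ (dichotomy φ) (dichotomy ψ)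
  dichotomy (φ ∨ᶠ ψ)  = dichotomy-∨ (dichotomy φ) (dichotomy ψ)
  dichotomy (φ ⇒ᶠ ψ)  = dichotomy-⇒ (dichotomy φ) (dichotomy ψ)


lemma6p2 : (A B₋₁ : MassProblem) (B : ℕ → MassProblem) → IntervalHyp A B₋₁ B →
    (Sig : Signature) (M : Obj) (𝔐 : Interval.Structure A B₋₁ B Sig M)
    (n : ℕ) (φ : Δ₀₀Formula Sig n) →
    Σ Code λ d → Σ Code λ Φ₁ → Σ Code λ Ψ₁ → Σ Code λ Φ₂ → Σ Code λ Ψ₂ →
    (a : Vec (Vec ℕ (dim M)) n) → All (InObj M) a →
    (Interval.Holds A B₋₁ B 𝔐 φ a
    × Ev zeroOracle d (code (concat a)) 0
    × URed Φ₁ (code (concat a)) (Interval.⟦_⟧ A B₋₁ B 𝔐 φ a) (Interval.Bt A B₋₁ B (concat a))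
    × URed Ψ₁ (code (concat a)) (Interval.Bt A B₋₁ B (concat a)) (Interval.⟦_⟧ A B₋₁ B 𝔐 φ a))
    ⊎
    (¬ Interval.Holds A B₋₁ B 𝔐 φ a
    × Ev zeroOracle d (code (concat a)) 1
    × URed Φ₂ (code (concat a)) (Interval.⟦_⟧ A B₋₁ B 𝔐 φ a) A
    × URed Ψ₂ (code (concat a)) A (Interval.⟦_⟧ A B₋₁ B 𝔐 φ a))
lemma6p2 A B₋₁ B hyp Sig M 𝔐 n φ = d , Φ₁ , Ψ₁ , Φ₂ , Ψ₂ , cases
  where
  open Dichotomies A B₋₁ B hyp Sig M 𝔐 n
  open Dichotomy (dichotomy φ)
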